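{- Let $n\in\mathbb{N}\cup\{\infty\}$, $A_n=\{1,2,\ldots,n\}$ (with $A_\infty=\{1,2,\dots\}$), and $1\le i<n$. Let $w_1,w_2,w_3,w_4\in A_n^*$ with $w_2\sim w_3$. Then there exist words $\widetilde{w_1},\widetilde{w_2},\widetilde{w_3},\widetilde{w_4}\in A_n^*$, with $\widetilde{w_j}$ of the same length as $w_j$ for each $j$ and $\widetilde{w_2}\sim\widetilde{w_3}$, such that $s_i(w_1w_2w_4)=\widetilde{w_1}\widetilde{w_2}\widetilde{w_4}$ and $s_i(w_1w_3w_4)=\widetilde{w_1}\widetilde{w_3}\widetilde{w_4}$.
   Context: $A_n$ carries its usual order. The Knuth equivalence $\sim$ on $A_n^*$ is the congruence generated by $xzy\sim zxy$ for $x\le y<z$ and $yxz\sim yzx$ for $x<y\le z$. The operator $s_i$ on $A_n^*$: given a word $w$, consider the subsequence $u$ of its letters equal to $i$ or $i+1$, regarded cyclically (the last letter of $u$ is followed by the first). Repeatedly match an unmatched letter $i+1$ with an unmatched letter $i$ that immediately follows it among the currently unmatched letters in this cyclic order, until no such pair remains; then the unmatched letters are either all equal to $i$ or all equal to $i+1$ (the set of matched letters does not depend on the choices). The word $s_i(w)$ is obtained from $w$ by changing every unmatched $i$ into $i+1$, resp. every unmatched $i+1$ into $i$, all other letters staying in place. -}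

module Defs where

open import Data.Nat using (ℕ; zero; suc; _≤_; _<_; _≟_)
open import Data.Bool using (Bool; true; false; if_then_else_; _∧_)
open import Data.List using (List; []; _∷_; _++_; length; map; reverse)
open import Data.Bool.ListAction using (any)
open import Data.Maybe using (Maybe; just; nothing)
open import Data.Product using (_×_; _,_; proj₁; proj₂)
open import Data.List.Relation.Unary.All using (All)
open import Relation.Nullary.Decidable using (⌊_⌋)

data ℕ∞ : Set where
  fin : ℕ → ℕ∞
  ∞   : ℕ∞

data _∈A_ (x : ℕ) : ℕ∞ → Set where
  inFin : ∀ {m} → 1 ≤ x → x ≤ m → x ∈A fin m
  inInf : 1 ≤ x → x ∈A ∞

data _<∞_ (x : ℕ) : ℕ∞ → Set where
  ltFin : ∀ {m} → x < m → x <∞ fin m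
  ltInf : x <∞ ∞

Word : ℕ∞ → List ℕ → Set
Word n w = All (_∈A n) w

data _∼_ : List ℕ → List ℕ → Set where
  knuth₁ : ∀ u v {x y z} → x ≤ y → y < z →
           (u ++ x ∷ z ∷ y ∷ v) ∼ (u ++ z ∷ x ∷ y ∷ v)
  knuth₂ : ∀ u v {x y z} → x < y → y ≤ z →
           (u ++ y ∷ x ∷ z ∷ v) ∼ (u ++ y ∷ z ∷ x ∷ v)
  ∼-refl  : ∀ {w} → w ∼ w
  ∼-sym   : ∀ {w w'} → w ∼ w' → w' ∼ w
  ∼-trans : ∀ {w w' w''} → w ∼ w' → w' ∼ w'' → w ∼ w''

-- Unmatched letters are kept as a list of (position, isUpper) in the
-- order of the word, where isUpper = true iff the letter is i+1.

_==_ : ℕ → ℕ → Bool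
a == b = ⌊ a ≟ b ⌋

indexFrom : ℕ → List ℕ → List (ℕ × ℕ)
indexFrom k []       = []
indexFrom k (x ∷ xs) = (k , x) ∷ indexFrom (suc k) xs

relevant : ℕ → List (ℕ × ℕ) → List (ℕ × Bool)
relevant i [] = []
relevant i ((p , x) ∷ xs) =
  if x == i then (p , false) ∷ relevant i xs
  else if x == suc i then (p , true) ∷ relevant i xs
  else relevant i xs

matchLinear : List (ℕ × Bool) → Maybe (List (ℕ × Bool))
matchLinear [] = nothing
matchLinear (a ∷ []) = nothing
matchLinear ((p , true) ∷ (q , false) ∷ rest) = just rest
matchLinear (a ∷ b ∷ rest) with matchLinear (b ∷ rest)
... | just r  = just (a ∷ r)
... | nothing = nothing

-- the wrap-around pair: last letter (i+1) followed cyclically by first (i)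
matchWrap : List (ℕ × Bool) → Maybe (List (ℕ × Bool))
matchWrap ((p , false) ∷ rest) with reverse rest
... | (q , true) ∷ mid = just (reverse mid)
... | _ = nothing
matchWrap _ = nothing

matchStep : List (ℕ × Bool) → Maybe (List (ℕ × Bool))
matchStep l with matchLinear l
... | just r  = just r
... | nothing = matchWrap l

-- repeat until no pair remains (fuel: each step removes two letters)
matchAll : ℕ → List (ℕ × Bool) → List (ℕ × Bool)
matchAll zero l = l
matchAll (suc k) l with matchStep l
... | just r  = matchAll k r
... | nothing = l

unmatched : ℕ → List ℕ → List ℕ
unmatched i w =
  let u = relevant i (indexFrom 0 w) in map proj₁ (matchAll (length u) u)

flipLetter : ℕ → List ℕ → ℕ × ℕ → ℕ
flipLetter i U (p , x) =
  if any (_== p) U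
  then (if x == i then suc i else if x == suc i then i else x)
  else x

s : ℕ → List ℕ → List ℕ
s i w = map (flipLetter i (unmatched i w)) (indexFrom 0 w)

module Submission where

-- Only the letters i and i+1 matter to s_i.  Its result, the list of unmatched marks, (1) does not change when an
-- adjacent pair "i+1 i" is deleted beforehand (reduce-cancel), (2) commutes
-- with renaming positions (reduce-relabel) and (3) consists of i's only or of
-- (i+1)'s only (reduce-homogeneous).  Via invariants of the procedure this
-- gives three facts about two adjacent marks: of two i's, if the first is
-- unmatched so is the second; of two (i+1)'s, if the second is unmatched so
-- is the first; a pair "i i+1" is never entirely unmatched.  Next we look at
-- a word as prefix, window of three letters and suffix, and show that for a
-- Knuth move x z y ~ z x y (resp. y x z ~ y z x) in the window, the unmatched
-- positions of both words correspond under a transposition of the window;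
-- hence s_i changes prefix and suffix alike, and the three facts say that the
-- images of the windows are again related by a Knuth move (local₁, local₂).
-- Since ∼ is the congruence generated by these moves, the theorem follows by
-- induction on the derivation of w₂ ∼ w₃ (agree-∼); the alphabet and length
-- conditions are bookkeeping at the end.

open import Defs
open import Data.Nat using (ℕ; _≤_)
open import Data.List using (List; _++_; length)
open import Data.Product using (Σ; _×_)
open import Relation.Binary.PropositionalEquality using (_≡_)

open import Data.Bool using (Bool; true; false; if_then_else_; _∨_)
open import Data.Bool.ListAction using (any)
open import Data.Empty using (⊥; ⊥-elim)
open import Data.Fin using (Fin; toℕ; zero; suc)
open import Data.Fin.Properties using (toℕ<n)
open import Data.List using ([]; _∷_; map; reverse; [_])
open import Data.List.Properties
  using (length-map; map-++; map-cong; map-cong-local; ++-assoc; reverse-map;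
         reverse-involutive; unfold-reverse; reverse-++; length-++; ∷-injective)
open import Data.List.Relation.Unary.All using (All; []; _∷_)
import Data.List.Relation.Unary.All as All
import Data.List.Relation.Unary.All.Properties as All
open import Data.List.Relation.Unary.Any using (Any; here; there)
open import Data.Maybe using (Maybe; just; nothing)
import Data.Maybe as Maybe
open import Data.Maybe.Properties using (just-injective)
open import Data.Nat using (zero; suc; _<_; _≟_; z≤n; s≤s; _+_)
open import Data.Nat.Properties
  using (≤-refl; ≤-trans; <-trans; ≤-<-trans; <-≤-trans; <-irrefl; <⇒≤; <⇒≱;
         <⇒≢; >⇒≢; ≤∧≢⇒<; ≤-antisym; ≤-pred; n≤1+n; n<1+n; m≤n+m; m<m+n;
         +-suc; +-comm; +-monoˡ-<; +-cancelˡ-≡; +-cancelʳ-≡; suc-injective)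
open import Data.Product using (_,_; proj₁; proj₂)
open import Data.Sum using (_⊎_; inj₁; inj₂)
import Data.Sum as Sum
open import Relation.Binary.PropositionalEquality
  using (_≢_; refl; sym; trans; cong; cong₂; subst; subst₂; ≢-sym; module ≡-Reasoning)
open import Relation.Nullary using (¬_; yes; no)

-- A mark records a letter i or i+1 of the word: its position and whether it
-- is i+1 (true) or i (false).
Mark : Set
Mark = ℕ × Bool

reduce : List Mark → List Mark
reduce l = matchAll (length l) l

NoPair : List Mark → Set
NoPair l = matchLinear l ≡ nothing

-- Stack normalisation: push a mark, cancelling it against an i below it when
-- it is an i+1.  normalise l cancels all linear pairs "i+1 i", right to left.
push : Mark → List Mark → List Mark
push (p , true) ((q , false) ∷ r) = r
push m r = m ∷ r

normalise : List Mark → List Mark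
normalise [] = []
normalise (m ∷ l) = push m (normalise l)

matchLinear-cases : ∀ a b rest {r} → matchLinear (a ∷ b ∷ rest) ≡ just r →
  (proj₂ a ≡ true × proj₂ b ≡ false × r ≡ rest) ⊎
  Σ (List Mark) λ r' → matchLinear (b ∷ rest) ≡ just r' × r ≡ a ∷ r'
matchLinear-cases (p , true) (q , false) rest refl = inj₁ (refl , refl , refl)
matchLinear-cases (p , true) (q , true) rest eq with matchLinear ((q , true) ∷ rest)
... | just r' = inj₂ (r' , refl , sym (just-injective eq))
matchLinear-cases (p , false) b rest eq with matchLinear (b ∷ rest)
... | just r' = inj₂ (r' , refl , sym (just-injective eq))

normalise-matchLinear : ∀ l {r} → matchLinear l ≡ just r → normalise r ≡ normalise l
normalise-matchLinear (a ∷ b ∷ rest) eq with matchLinear-cases a b rest eq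
... | inj₁ (refl , refl , refl) = refl
... | inj₂ (r' , e , refl) = cong (push a) (normalise-matchLinear (b ∷ rest) e)

length-matchLinear : ∀ l {r} → matchLinear l ≡ just r → length l ≡ 2 + length r
length-matchLinear (a ∷ b ∷ rest) eq with matchLinear-cases a b rest eq
... | inj₁ (refl , refl , refl) = refl
... | inj₂ (r' , e , refl) = cong suc (length-matchLinear (b ∷ rest) e)

noPair-tail : ∀ a l → NoPair (a ∷ l) → NoPair l
noPair-tail a [] _ = refl
noPair-tail (p , true) ((q , true) ∷ rest) eq with matchLinear ((q , true) ∷ rest)
... | nothing = refl
noPair-tail (p , false) (b ∷ rest) eq with matchLinear (b ∷ rest)
... | nothing = refl

noPair-cons : ∀ a b rest → NoPair (b ∷ rest) →
  NoPair (a ∷ b ∷ rest) ⊎ (proj₂ a ≡ true × proj₂ b ≡ false)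
noPair-cons (p , true) (q , false) rest h = inj₂ (refl , refl)
noPair-cons (p , true) (q , true) rest h rewrite h = inj₁ refl
noPair-cons (p , false) b rest h rewrite h = inj₁ refl

noPair-init : ∀ l e → NoPair (l ++ [ e ]) → NoPair l
noPair-init [] e _ = refl
noPair-init (a ∷ []) e _ = refl
noPair-init (a ∷ b ∷ rest) e eq
  with noPair-cons a b rest (noPair-init (b ∷ rest) e (noPair-tail a (b ∷ rest ++ [ e ]) eq))
... | inj₁ h = h
noPair-init ((p , true) ∷ (q , false) ∷ rest) e () | inj₂ (refl , refl)

push-noPair : ∀ a l → NoPair (a ∷ l) → push a l ≡ a ∷ l
push-noPair (p , false) l _ = refl
push-noPair (p , true) [] _ = refl
push-noPair (p , true) ((q , true) ∷ l) _ = refl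

normalise-noPair : ∀ l → NoPair l → normalise l ≡ l
normalise-noPair [] _ = refl
normalise-noPair (a ∷ l) eq =
  trans (cong (push a) (normalise-noPair l (noPair-tail a l eq))) (push-noPair a l eq)

push-keeps-noPair : ∀ a m → NoPair m → NoPair (push a m)
push-keeps-noPair (p , true) [] h = refl
push-keeps-noPair (p , true) ((q , false) ∷ r) h = noPair-tail (q , false) r h
push-keeps-noPair (p , true) ((q , true) ∷ r) h rewrite h = refl
push-keeps-noPair (p , false) [] h = refl
push-keeps-noPair (p , false) (b ∷ r) h rewrite h = refl

noPair-normalise : ∀ l → NoPair (normalise l)
noPair-normalise [] = refl
noPair-normalise (a ∷ l) = push-keeps-noPair a (normalise l) (noPair-normalise l)

wrapTail : List Mark → Maybe (List Mark)
wrapTail ((q , true) ∷ mid) = just (reverse mid)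
wrapTail _ = nothing

matchWrap-reverse : ∀ p rest → matchWrap ((p , false) ∷ rest) ≡ wrapTail (reverse rest)
matchWrap-reverse p rest with reverse rest
... | [] = refl
... | (q , true) ∷ mid = refl
... | (q , false) ∷ mid = refl

matchWrap-shape : ∀ l {r} → matchWrap l ≡ just r →
  Σ ℕ λ p → Σ ℕ λ q → l ≡ (p , false) ∷ r ++ [ (q , true) ]
matchWrap-shape ((p , false) ∷ rest) {r} eq
  rewrite matchWrap-reverse p rest = shape (reverse rest) refl eq
  where
  shape : ∀ v → reverse rest ≡ v → wrapTail v ≡ just r →
    Σ ℕ λ p' → Σ ℕ λ q → (p , false) ∷ rest ≡ (p' , false) ∷ r ++ [ (q , true) ]
  shape ((q , true) ∷ mid) ev refl = p , q , cong ((p , false) ∷_) (begin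
      rest                         ≡⟨ sym (reverse-involutive rest) ⟩
      reverse (reverse rest)       ≡⟨ cong reverse ev ⟩
      reverse ((q , true) ∷ mid)   ≡⟨ unfold-reverse (q , true) mid ⟩
      reverse mid ++ [ (q , true) ] ∎)
    where open ≡-Reasoning

matchWrap-apply : ∀ p q r → matchWrap ((p , false) ∷ r ++ [ (q , true) ]) ≡ just r
matchWrap-apply p q r
  rewrite matchWrap-reverse p (r ++ [ (q , true) ]) | reverse-++ r [ (q , true) ]
        | reverse-involutive r = refl

length-matchWrap : ∀ m {r} → matchWrap m ≡ just r → length m ≡ 2 + length r
length-matchWrap m {r} h with matchWrap-shape m h
... | p , q , refl rewrite length-++ r {[ (q , true) ]} = cong suc (+-comm (length r) 1)

noPair-matchWrap : ∀ m {r} → NoPair m → matchWrap m ≡ just r → NoPair r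
noPair-matchWrap m {r} h₁ h₂ with matchWrap-shape m h₂
... | p , q , refl = noPair-init r (q , true) (noPair-tail (p , false) (r ++ [ (q , true) ]) h₁)

matchStep-linear : ∀ m {r} → matchLinear m ≡ just r → matchStep m ≡ just r
matchStep-linear m h with matchLinear m
... | just _ = h

matchStep-wrap : ∀ m → NoPair m → matchStep m ≡ matchWrap m
matchStep-wrap m h with matchLinear m
... | nothing = refl

matchAll-step : ∀ k m {r} → matchStep m ≡ just r → matchAll (suc k) m ≡ matchAll k r
matchAll-step k m h with matchStep m
... | just r' = cong (matchAll k) (just-injective h)

matchAll-stop : ∀ k m → matchStep m ≡ nothing → matchAll (suc k) m ≡ m
matchAll-stop k m h with matchStep m
... | nothing = refl

matchAll-[] : ∀ k → matchAll k [] ≡ []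
matchAll-[] zero = refl
matchAll-[] (suc k) = refl

length≤0 : ∀ (m : List Mark) → length m ≤ 0 → m ≡ []
length≤0 [] _ = refl

two-less : ∀ {a b} → suc (suc a) ≤ suc b → a ≤ b
two-less (s≤s h) = ≤-trans (n≤1+n _) h

-- Every step removes two marks, so any fuel ≥ length gives the same result
-- (stated for lists without linear pairs, where only cyclic steps occur).
matchAll-fuel : ∀ m k k' → NoPair m → length m ≤ k → length m ≤ k' →
  matchAll k m ≡ matchAll k' m
matchAll-fuel m zero k' h l l' rewrite length≤0 m l = sym (matchAll-[] k')
matchAll-fuel m (suc k) zero h l l' rewrite length≤0 m l' = matchAll-[] (suc k)
matchAll-fuel m (suc k) (suc k') h l l' with matchWrap m in e
... | just r =
  let step = trans (matchStep-wrap m h) e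
      len = length-matchWrap m e
  in trans (matchAll-step k m step)
       (trans (matchAll-fuel r k k' (noPair-matchWrap m h e)
                (two-less (subst (_≤ suc k) len l)) (two-less (subst (_≤ suc k') len l')))
         (sym (matchAll-step k' m step)))
... | nothing =
  let stop = trans (matchStep-wrap m h) e
  in trans (matchAll-stop k m stop) (sym (matchAll-stop k' m stop))

-- The linear steps performed by the procedure compute the normal form.
matchAll-normalise : ∀ k l k' → length l ≤ k → length (normalise l) ≤ k' →
  matchAll k l ≡ matchAll k' (normalise l)
matchAll-normalise zero l k' l₁ l₂ rewrite length≤0 l l₁ = sym (matchAll-[] k')
matchAll-normalise (suc k) l k' l₁ l₂ = byFirstStep (matchLinear l) refl
  where
  byFirstStep : ∀ v → matchLinear l ≡ v → matchAll (suc k) l ≡ matchAll k' (normalise l)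
  byFirstStep (just r) e =
    trans (matchAll-step k l (matchStep-linear l e))
      (trans (matchAll-normalise k r k'
                (two-less (subst (_≤ suc k) (length-matchLinear l e) l₁))
                (subst (λ t → length t ≤ k') (sym (normalise-matchLinear l e)) l₂))
        (cong (matchAll k') (normalise-matchLinear l e)))
  byFirstStep nothing e =
    trans (matchAll-fuel l (suc k) k' e l₁ (subst (λ t → length t ≤ k') (normalise-noPair l e) l₂))
      (cong (matchAll k') (sym (normalise-noPair l e)))

reduce-normalise : ∀ l → reduce l ≡ reduce (normalise l)
reduce-normalise l = matchAll-normalise (length l) l (length (normalise l)) ≤-refl ≤-refl

normalise-cancel : ∀ P p q Q → normalise (P ++ (p , true) ∷ (q , false) ∷ Q) ≡ normalise (P ++ Q)
normalise-cancel [] p q Q = refl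
normalise-cancel (x ∷ P) p q Q = cong (push x) (normalise-cancel P p q Q)

reduce-cancel : ∀ P p q Q → reduce (P ++ (p , true) ∷ (q , false) ∷ Q) ≡ reduce (P ++ Q)
reduce-cancel P p q Q = begin
  reduce (P ++ (p , true) ∷ (q , false) ∷ Q)             ≡⟨ reduce-normalise (P ++ (p , true) ∷ (q , false) ∷ Q) ⟩
  reduce (normalise (P ++ (p , true) ∷ (q , false) ∷ Q)) ≡⟨ cong reduce (normalise-cancel P p q Q) ⟩
  reduce (normalise (P ++ Q))                            ≡⟨ reduce-normalise (P ++ Q) ⟨
  reduce (P ++ Q)                                        ∎
  where open ≡-Reasoning

-- (2) The procedure only looks at the i/i+1 pattern, so it commutes with
-- renaming the positions.
relabelMark : (ℕ → ℕ) → Mark → Mark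
relabelMark f (p , b) = (f p , b)

relabel : (ℕ → ℕ) → List Mark → List Mark
relabel f = map (relabelMark f)

matchLinear-relabel : ∀ f l → matchLinear (relabel f l) ≡ Maybe.map (relabel f) (matchLinear l)
matchLinear-relabel f [] = refl
matchLinear-relabel f ((p , b) ∷ []) = refl
matchLinear-relabel f ((p , true) ∷ (q , false) ∷ rest) = refl
matchLinear-relabel f ((p , true) ∷ (q , true) ∷ rest)
  rewrite matchLinear-relabel f ((q , true) ∷ rest) with matchLinear ((q , true) ∷ rest)
... | just r = refl
... | nothing = refl
matchLinear-relabel f ((p , false) ∷ (q , b) ∷ rest)
  rewrite matchLinear-relabel f ((q , b) ∷ rest) with matchLinear ((q , b) ∷ rest)
... | just r = refl
... | nothing = refl

wrapTail-relabel : ∀ f v → wrapTail (relabel f v) ≡ Maybe.map (relabel f) (wrapTail v)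
wrapTail-relabel f [] = refl
wrapTail-relabel f ((q , true) ∷ mid) = cong just (sym (reverse-map (relabelMark f) mid))
wrapTail-relabel f ((q , false) ∷ mid) = refl

matchWrap-relabel : ∀ f l → matchWrap (relabel f l) ≡ Maybe.map (relabel f) (matchWrap l)
matchWrap-relabel f [] = refl
matchWrap-relabel f ((p , true) ∷ rest) = refl
matchWrap-relabel f ((p , false) ∷ rest)
  rewrite matchWrap-reverse (f p) (relabel f rest) | matchWrap-reverse p rest
        | sym (reverse-map (relabelMark f) rest) = wrapTail-relabel f (reverse rest)

matchStep-relabel : ∀ f l → matchStep (relabel f l) ≡ Maybe.map (relabel f) (matchStep l)
matchStep-relabel f l = byLinear (matchLinear l) refl
  where
  linear : ∀ {v} → matchLinear l ≡ v → matchLinear (relabel f l) ≡ Maybe.map (relabel f) v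
  linear e = trans (matchLinear-relabel f l) (cong (Maybe.map (relabel f)) e)
  byLinear : ∀ v → matchLinear l ≡ v →
    matchStep (relabel f l) ≡ Maybe.map (relabel f) (matchStep l)
  byLinear (just r) e =
    trans (matchStep-linear (relabel f l) (linear e))
      (cong (Maybe.map (relabel f)) (sym (matchStep-linear l e)))
  byLinear nothing e =
    trans (matchStep-wrap (relabel f l) (linear e))
      (trans (matchWrap-relabel f l) (cong (Maybe.map (relabel f)) (sym (matchStep-wrap l e))))

matchAll-relabel : ∀ f k l → matchAll k (relabel f l) ≡ relabel f (matchAll k l)
matchAll-relabel f zero l = refl
matchAll-relabel f (suc k) l = byStep (matchStep l) refl
  where
  step : ∀ {v} → matchStep l ≡ v → matchStep (relabel f l) ≡ Maybe.map (relabel f) v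
  step e = trans (matchStep-relabel f l) (cong (Maybe.map (relabel f)) e)
  byStep : ∀ v → matchStep l ≡ v → matchAll (suc k) (relabel f l) ≡ relabel f (matchAll (suc k) l)
  byStep (just r) e =
    trans (matchAll-step k (relabel f l) (step e))
      (trans (matchAll-relabel f k r) (cong (relabel f) (sym (matchAll-step k l e))))
  byStep nothing e =
    trans (matchAll-stop k (relabel f l) (step e)) (cong (relabel f) (sym (matchAll-stop k l e)))

reduce-relabel : ∀ f l → reduce (relabel f l) ≡ relabel f (reduce l)
reduce-relabel f l rewrite length-map (relabelMark f) l = matchAll-relabel f (length l) l

-- The procedure only deletes marks, so properties of all marks persist.
module _ {P : Mark → Set} where

  All-matchLinear : ∀ l {r} → All P l → matchLinear l ≡ just r → All P r
  All-matchLinear (a ∷ b ∷ rest) (pa ∷ pb ∷ pr) eq with matchLinear-cases a b rest eq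
  ... | inj₁ (refl , refl , refl) = pr
  ... | inj₂ (r' , e , refl) = pa ∷ All-matchLinear (b ∷ rest) (pb ∷ pr) e

  All-matchWrap : ∀ l {r} → All P l → matchWrap l ≡ just r → All P r
  All-matchWrap l {r} al h with matchWrap-shape l h
  ... | p , q , refl with al
  ... | _ ∷ al' = All.++⁻ˡ r al'

  All-matchStep : ∀ l {r} → All P l → matchStep l ≡ just r → All P r
  All-matchStep l al h = byLinear (matchLinear l) refl
    where
    byLinear : ∀ v → matchLinear l ≡ v → All P _
    byLinear (just r') e = All-matchLinear l al (trans e (trans (sym (matchStep-linear l e)) h))
    byLinear nothing e = All-matchWrap l al (trans (sym (matchStep-wrap l e)) h)

  All-matchAll : ∀ k l → All P l → All P (matchAll k l)
  All-matchAll zero l al = al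
  All-matchAll (suc k) l al = byStep (matchStep l) refl
    where
    byStep : ∀ v → matchStep l ≡ v → All P (matchAll (suc k) l)
    byStep (just r) e rewrite matchAll-step k l e = All-matchAll k r (All-matchStep l al e)
    byStep nothing e rewrite matchAll-stop k l e = al

  All-reduce : ∀ l → All P l → All P (reduce l)
  All-reduce l = All-matchAll (length l) l

  All-push : ∀ e r → All P (e ∷ r) → All P (push e r)
  All-push (p , true) ((q , false) ∷ r) (_ ∷ _ ∷ a) = a
  All-push (p , true) [] a = a
  All-push (p , true) ((q , true) ∷ r) a = a
  All-push (p , false) r a = a

  All-normalise : ∀ l → All P l → All P (normalise l)
  All-normalise [] a = a
  All-normalise (x ∷ l) (px ∷ a) = All-push x (normalise l) (px ∷ All-normalise l a)

IsUpper IsLower : Mark → Set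
IsUpper m = proj₂ m ≡ true
IsLower m = proj₂ m ≡ false

length-matchStep : ∀ l {r} → matchStep l ≡ just r → length l ≡ 2 + length r
length-matchStep l {r} e = byLinear (matchLinear l) refl
  where
  byLinear : ∀ v → matchLinear l ≡ v → length l ≡ 2 + length r
  byLinear (just r') e' = length-matchLinear l (trans e' (trans (sym (matchStep-linear l e')) e))
  byLinear nothing e' = length-matchWrap l (trans (sym (matchStep-wrap l e')) e)

matchStep-final : ∀ k l → length l ≤ k → matchStep (matchAll k l) ≡ nothing
matchStep-final zero l h rewrite length≤0 l h = refl
matchStep-final (suc k) l h = byStep (matchStep l) refl
  where
  byStep : ∀ v → matchStep l ≡ v → matchStep (matchAll (suc k) l) ≡ nothing
  byStep (just r) e rewrite matchAll-step k l e =
    matchStep-final k r (two-less (subst (_≤ suc k) (length-matchStep l e) h))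
  byStep nothing e rewrite matchAll-stop k l e = e

matchStep-stuck : ∀ m → matchStep m ≡ nothing → NoPair m × matchWrap m ≡ nothing
matchStep-stuck m h = byLinear (matchLinear m) refl
  where
  byLinear : ∀ v → matchLinear m ≡ v → NoPair m × matchWrap m ≡ nothing
  byLinear (just r) e with trans (sym (matchStep-linear m e)) h
  ... | ()
  byLinear nothing e = e , trans (sym (matchStep-wrap m e)) h

noPair-after-upper : ∀ p l → NoPair ((p , true) ∷ l) → All IsUpper l
noPair-after-upper p [] h = []
noPair-after-upper p ((q , true) ∷ l) h =
  refl ∷ noPair-after-upper q l (noPair-tail (p , true) ((q , true) ∷ l) h)

ends-upper : ∀ p l → All IsUpper l →
  Σ ℕ λ q → Σ (List Mark) λ mid → (p , true) ∷ l ≡ mid ++ [ (q , true) ]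
ends-upper p [] _ = p , [] , refl
ends-upper p ((q , b) ∷ l) (refl ∷ a) with ends-upper q l a
... | q' , mid , e = q' , (p , true) ∷ mid , cong ((p , true) ∷_) e

noPair-shape : ∀ l → NoPair l →
  All IsLower l ⊎ Σ ℕ λ q → Σ (List Mark) λ mid → l ≡ mid ++ [ (q , true) ]
noPair-shape [] h = inj₁ []
noPair-shape ((p , true) ∷ l) h = inj₂ (ends-upper p l (noPair-after-upper p l h))
noPair-shape ((p , false) ∷ l) h with noPair-shape l (noPair-tail (p , false) l h)
... | inj₁ a = inj₁ (refl ∷ a)
... | inj₂ (q , mid , e) = inj₂ (q , (p , false) ∷ mid , cong ((p , false) ∷_) e)

-- If no step applies, the list starts with an i+1 (and then is all i+1's) or
-- cannot end with an i+1 (else a cyclic step applies).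
stuck-homogeneous : ∀ m → NoPair m → matchWrap m ≡ nothing → All IsUpper m ⊎ All IsLower m
stuck-homogeneous [] _ _ = inj₁ []
stuck-homogeneous ((p , true) ∷ l) h₁ h₂ = inj₁ (refl ∷ noPair-after-upper p l h₁)
stuck-homogeneous ((p , false) ∷ l) h₁ h₂ with noPair-shape l (noPair-tail (p , false) l h₁)
... | inj₁ a = inj₂ (refl ∷ a)
... | inj₂ (q , mid , refl) with trans (sym (matchWrap-apply p q mid)) h₂
... | ()

reduce-homogeneous : ∀ l → All IsUpper (reduce l) ⊎ All IsLower (reduce l)
reduce-homogeneous l with matchStep-stuck (reduce l) (matchStep-final (length l) l ≤-refl)
... | h₁ , h₂ = stuck-homogeneous (reduce l) h₁ h₂

Fresh : ℕ → List Mark → Set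
Fresh p = All (λ m → proj₁ m ≢ p)

Mem : ℕ → List Mark → Set
Mem p = Any (λ m → proj₁ m ≡ p)

Mem-Fresh : ∀ {p l} → Mem p l → Fresh p l → ⊥
Mem-Fresh (here e) (f ∷ _) = f e
Mem-Fresh (there a) (_ ∷ f) = Mem-Fresh a f

Preserved : (List Mark → Set) → Set
Preserved Inv = ∀ m {r} → matchWrap m ≡ just r → Inv m → Inv r

invariant-matchAll : ∀ (Inv : List Mark → Set) → Preserved Inv → ∀ k m → NoPair m → Inv m → Inv (matchAll k m)
invariant-matchAll Inv pres zero m h i = i
invariant-matchAll Inv pres (suc k) m h i = byWrap (matchWrap m) refl
  where
  byWrap : ∀ v → matchWrap m ≡ v → Inv (matchAll (suc k) m)
  byWrap (just r) e rewrite matchAll-step k m (trans (matchStep-wrap m h) e) =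
    invariant-matchAll Inv pres k r (noPair-matchWrap m h e) (pres m e i)
  byWrap nothing e rewrite matchAll-stop k m (trans (matchStep-wrap m h) e) = i

reduce-invariant : ∀ (Inv : List Mark → Set) → Preserved Inv → ∀ u → Inv (normalise u) → Inv (reduce u)
reduce-invariant Inv pres u i =
  subst Inv (sym (reduce-normalise u))
    (invariant-matchAll Inv pres (length (normalise u)) (normalise u) (noPair-normalise u) i)

-- The normal form of P ++ X is obtained by pushing the marks of P onto that of X.
invariant-normalise : ∀ (Inv : List Mark → Set) P X → All (λ e → ∀ m → Inv m → Inv (push e m)) P →
  Inv (normalise X) → Inv (normalise (P ++ X))
invariant-normalise Inv [] X _ i = i
invariant-normalise Inv (x ∷ P) X (c ∷ cs) i = c (normalise (P ++ X)) (invariant-normalise Inv P X cs i)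

-- Two adjacent i's at positions la, lb: if la is unmatched, so is lb.
-- Invariant: la has disappeared, or it is still immediately followed by lb
-- and la does not occur later.
module LowerPair (la lb : ℕ) (la≢lb : la ≢ lb) where

  data Adjacent : List Mark → Set where
    here  : ∀ Y → Fresh la Y → Adjacent ((la , false) ∷ (lb , false) ∷ Y)
    there : ∀ x m → Adjacent m → Adjacent (x ∷ m)

  Inv : List Mark → Set
  Inv m = Fresh la m ⊎ Adjacent m

  push-Inv : ∀ e → proj₁ e ≢ la → ∀ m → Inv m → Inv (push e m)
  push-Inv e n m (inj₁ fr) = inj₁ (All-push e m (n ∷ fr))
  push-Inv (p , true) n _ (inj₂ (here Y fy)) = inj₁ (≢-sym la≢lb ∷ fy)
  push-Inv (p , false) n _ (inj₂ (here Y fy)) = inj₂ (there _ _ (here Y fy))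
  push-Inv (p , true) n ((q , false) ∷ m) (inj₂ (there _ _ a)) = inj₂ a
  push-Inv (p , true) n ((q , true) ∷ m) (inj₂ (there _ _ a)) = inj₂ (there _ _ (there _ _ a))
  push-Inv (p , false) n (x ∷ m) (inj₂ (there _ _ a)) = inj₂ (there _ _ (there _ _ a))

  Adjacent-init : ∀ {t} → Adjacent t → ∀ r q → t ≡ r ++ [ (q , true) ] → Adjacent r
  Adjacent-init (here Y fy) (x ∷ y ∷ r) q refl = here r (All.++⁻ˡ r fy)
  Adjacent-init (there x m ()) [] q refl
  Adjacent-init (there x m a) (y ∷ r) q refl = there y r (Adjacent-init a r q refl)

  preserved : Preserved Inv
  preserved m {r} h i with matchWrap-shape m h
  ... | p , q , refl with i
  ... | inj₁ (_ ∷ fr) = inj₁ (All.++⁻ˡ r fr)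
  ... | inj₂ a = dropFirst a refl refl
    where
    dropFirst : ∀ {t t'} → Adjacent t → t ≡ (p , false) ∷ t' → t' ≡ r ++ [ (q , true) ] → Inv r
    dropFirst (here Y fy) refl e = inj₁ (All.++⁻ˡ r (subst (Fresh la) e (≢-sym la≢lb ∷ fy)))
    dropFirst (there x m a') refl e = inj₂ (Adjacent-init a' r q e)

  Adjacent-Mem : ∀ {m} → Adjacent m → Mem lb m
  Adjacent-Mem (here Y _) = there (here refl)
  Adjacent-Mem (there x m a) = there (Adjacent-Mem a)

  lowerPair-survives : ∀ P Q → Fresh la P → Fresh la Q →
    Mem la (reduce (P ++ (la , false) ∷ (lb , false) ∷ Q)) →
    Mem lb (reduce (P ++ (la , false) ∷ (lb , false) ∷ Q))
  lowerPair-survives P Q fP fQ mem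
    with reduce-invariant Inv preserved (P ++ (la , false) ∷ (lb , false) ∷ Q)
           (invariant-normalise Inv P (_ ∷ _ ∷ Q) (All.map (λ {e} n → push-Inv e n) fP)
             (inj₂ (here (normalise Q) (All-normalise Q fQ))))
  ... | inj₁ fr = ⊥-elim (Mem-Fresh mem fr)
  ... | inj₂ a = Adjacent-Mem a

-- Two adjacent (i+1)'s at positions la, lb: if lb is unmatched, so is la.
-- Invariant: lb has disappeared, or it is still immediately preceded by la
-- and lb does not occur earlier.
module UpperPair (la lb : ℕ) (la≢lb : la ≢ lb) where

  data Adjacent : List Mark → Set where
    here  : ∀ Y → Adjacent ((la , true) ∷ (lb , true) ∷ Y)
    there : ∀ x m → proj₁ x ≢ lb → Adjacent m → Adjacent (x ∷ m)

  Inv : List Mark → Set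
  Inv m = Fresh lb m ⊎ Adjacent m

  push-Inv : ∀ e → proj₁ e ≢ lb → ∀ m → Inv m → Inv (push e m)
  push-Inv e n m (inj₁ fr) = inj₁ (All-push e m (n ∷ fr))
  push-Inv (p , true) n _ (inj₂ (here Y)) = inj₂ (there _ _ n (here Y))
  push-Inv (p , false) n _ (inj₂ (here Y)) = inj₂ (there _ _ n (here Y))
  push-Inv (p , true) n ((q , false) ∷ m) (inj₂ (there _ _ _ a)) = inj₂ a
  push-Inv (p , true) n ((q , true) ∷ m) (inj₂ (there _ _ nx a)) = inj₂ (there _ _ n (there _ _ nx a))
  push-Inv (p , false) n (x ∷ m) (inj₂ (there _ _ nx a)) = inj₂ (there _ _ n (there _ _ nx a))

  Adjacent-init : ∀ {t} → Adjacent t → ∀ r q → t ≡ r ++ [ (q , true) ] → Inv r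
  Adjacent-init (here Y) [] q ()
  Adjacent-init (here Y) (x ∷ []) q refl = inj₁ (la≢lb ∷ [])
  Adjacent-init (here Y) (x ∷ y ∷ r) q refl = inj₂ (here r)
  Adjacent-init (there x m nx ()) [] q refl
  Adjacent-init (there x m nx a) (y ∷ r) q refl with Adjacent-init a r q refl
  ... | inj₁ fr = inj₁ (nx ∷ fr)
  ... | inj₂ a' = inj₂ (there y r nx a')

  preserved : Preserved Inv
  preserved m {r} h i with matchWrap-shape m h
  ... | p , q , refl with i
  ... | inj₁ (_ ∷ fr) = inj₁ (All.++⁻ˡ r fr)
  ... | inj₂ (there _ _ _ a) = Adjacent-init a r q refl

  Adjacent-Mem : ∀ {m} → Adjacent m → Mem la m
  Adjacent-Mem (here Y) = here refl
  Adjacent-Mem (there x m _ a) = there (Adjacent-Mem a)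

  -- Normalising (la , i+1) ∷ (lb , i+1) ∷ Q: the two marks stay adjacent
  -- unless lb is cancelled by an i of normalise Q.
  initial : ∀ Q → Fresh la Q → Fresh lb Q → Inv (normalise ((la , true) ∷ (lb , true) ∷ Q))
  initial Q fa fb = byHead (normalise Q) (All-normalise Q fb)
    where
    byHead : ∀ v → Fresh lb v → Inv (push (la , true) (push (lb , true) v))
    byHead [] f = inj₂ (here [])
    byHead ((q , true) ∷ r) f = inj₂ (here _)
    byHead ((q , false) ∷ r) (_ ∷ f) = inj₁ (All-push (la , true) r (la≢lb ∷ f))

  upperPair-survives : ∀ P Q → Fresh lb P → Fresh la Q → Fresh lb Q →
    Mem lb (reduce (P ++ (la , true) ∷ (lb , true) ∷ Q)) →
    Mem la (reduce (P ++ (la , true) ∷ (lb , true) ∷ Q))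
  upperPair-survives P Q fP fa fb mem
    with reduce-invariant Inv preserved (P ++ (la , true) ∷ (lb , true) ∷ Q)
           (invariant-normalise Inv P (_ ∷ _ ∷ Q) (All.map (λ {e} n → push-Inv e n) fP) (initial Q fa fb))
  ... | inj₁ fr = ⊥-elim (Mem-Fresh mem fr)
  ... | inj₂ a = Adjacent-Mem a

open LowerPair using (lowerPair-survives)
open UpperPair using (upperPair-survives)

cancelledPair-gone : ∀ P Q la lb p → Fresh p (P ++ Q) →
  ¬ Mem p (reduce (P ++ (la , true) ∷ (lb , false) ∷ Q))
cancelledPair-gone P Q la lb p f m rewrite reduce-cancel P la lb Q =
  Mem-Fresh m (All-reduce (P ++ Q) f)

-- An adjacent pair "i i+1" is never entirely unmatched, by homogeneity.
Any-All : ∀ {A B C : Mark → Set} {m} → Any A m → All B m → All C m → Σ Mark λ e → A e × B e × C e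
Any-All (here x) (q ∷ _) (r ∷ _) = _ , x , q , r
Any-All (there a) (_ ∷ qs) (_ ∷ rs) = Any-All a qs rs

mixedPair-not-both : ∀ P Q la lb → la ≢ lb → Fresh la P → Fresh lb P → Fresh la Q → Fresh lb Q →
  Mem la (reduce (P ++ (la , false) ∷ (lb , true) ∷ Q)) →
  Mem lb (reduce (P ++ (la , false) ∷ (lb , true) ∷ Q)) → ⊥
mixedPair-not-both P Q la lb ne faP fbP faQ fbQ ma mb = byKind (reduce-homogeneous u)
  where
  u = P ++ (la , false) ∷ (lb , true) ∷ Q
  AtLa AtLb : Mark → Set
  AtLa e = proj₁ e ≡ la → IsLower e
  AtLb e = proj₁ e ≡ lb → IsUpper e
  absent : ∀ {p} {G : Mark → Set} {l} → Fresh p l → All (λ e → proj₁ e ≡ p → G e) l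
  absent = All.map (λ n e → ⊥-elim (n e))
  atLa : All AtLa u
  atLa = All.++⁺ (absent faP) ((λ _ → refl) ∷ (λ e → ⊥-elim (ne (sym e))) ∷ absent faQ)
  atLb : All AtLb u
  atLb = All.++⁺ (absent fbP) ((λ e → ⊥-elim (ne e)) ∷ (λ _ → refl) ∷ absent fbQ)
  byKind : All IsUpper (reduce u) ⊎ All IsLower (reduce u) → ⊥
  byKind (inj₁ up) with Any-All ma (All-reduce u atLa) up
  ... | e , p , g , t with trans (sym (g p)) t
  ... | ()
  byKind (inj₂ low) with Any-All mb (All-reduce u atLb) low
  ... | e , p , g , f with trans (sym (g p)) f
  ... | ()

==-refl : ∀ a → (a == a) ≡ true
==-refl a with a ≟ a
... | yes _ = refl
... | no n = ⊥-elim (n refl)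

==-no : ∀ {a b} → a ≢ b → (a == b) ≡ false
==-no {a} {b} n with a ≟ b
... | yes e = ⊥-elim (n e)
... | no _ = refl

==-yes : ∀ {a b} → (a == b) ≡ true → a ≡ b
==-yes {a} {b} h with a ≟ b
... | yes e = e

==-cong : ∀ a b c d → (a ≡ b → c ≡ d) → (c ≡ d → a ≡ b) → (a == b) ≡ (c == d)
==-cong a b c d f g with a ≟ b | c ≟ d
... | yes _ | yes _ = refl
... | no _ | no _ = refl
... | yes e | no n = ⊥-elim (n (f e))
... | no n | yes e = ⊥-elim (n (g e))

suc≢ : ∀ i → suc i ≢ i
suc≢ i e = <-irrefl (sym e) (n<1+n i)

indexFrom-++ : ∀ k xs ys → indexFrom k (xs ++ ys) ≡ indexFrom k xs ++ indexFrom (length xs + k) ys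
indexFrom-++ k [] ys = refl
indexFrom-++ k (x ∷ xs) ys rewrite indexFrom-++ (suc k) xs ys | +-suc (length xs) k = refl

length-indexFrom : ∀ k w → length (indexFrom k w) ≡ length w
length-indexFrom k [] = refl
length-indexFrom k (x ∷ w) = cong suc (length-indexFrom (suc k) w)

indexFrom-≥ : ∀ k w → All (λ e → k ≤ proj₁ e) (indexFrom k w)
indexFrom-≥ k [] = []
indexFrom-≥ k (x ∷ w) = ≤-refl ∷ All.map (≤-trans (n≤1+n k)) (indexFrom-≥ (suc k) w)

indexFrom-< : ∀ k w → All (λ e → proj₁ e < k + length w) (indexFrom k w)
indexFrom-< k [] = []
indexFrom-< k (x ∷ w) =
  m<m+n k (s≤s z≤n) ∷
  subst (λ n → All (λ e → proj₁ e < n) (indexFrom (suc k) w)) (sym (+-suc k (length w))) (indexFrom-< (suc k) w)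

marks : ℕ → List ℕ → List Mark
marks i w = relevant i (indexFrom 0 w)

markOf : ℕ → ℕ → ℕ → List Mark
markOf i p c = relevant i ((p , c) ∷ [])

relevant-∷ : ∀ i p c l → relevant i ((p , c) ∷ l) ≡ markOf i p c ++ relevant i l
relevant-∷ i p c l with c == i
... | true = refl
... | false with c == suc i
... | true = refl
... | false = refl

relevant-++ : ∀ i l₁ l₂ → relevant i (l₁ ++ l₂) ≡ relevant i l₁ ++ relevant i l₂
relevant-++ i [] l₂ = refl
relevant-++ i ((p , c) ∷ l₁) l₂
  rewrite relevant-∷ i p c (l₁ ++ l₂) | relevant-∷ i p c l₁ | relevant-++ i l₁ l₂ =
  sym (++-assoc (markOf i p c) (relevant i l₁) (relevant i l₂))

markOf-lower : ∀ i p → markOf i p i ≡ (p , false) ∷ []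
markOf-lower i p rewrite ==-refl i = refl

markOf-upper : ∀ i p → markOf i p (suc i) ≡ (p , true) ∷ []
markOf-upper i p rewrite ==-no (suc≢ i) | ==-refl (suc i) = refl

Relevant Irrelevant : ℕ → ℕ → Set
Relevant i c = c ≡ i ⊎ c ≡ suc i
Irrelevant i c = c ≢ i × c ≢ suc i

markOf-irrelevant : ∀ i p c → Irrelevant i c → markOf i p c ≡ []
markOf-irrelevant i p c (n₁ , n₂) rewrite ==-no n₁ | ==-no n₂ = refl

markOf-relabel : ∀ i σ p c → relabel σ (markOf i p c) ≡ markOf i (σ p) c
markOf-relabel i σ p c with c == i
... | true = refl
... | false with c == suc i
... | true = refl
... | false = refl

All-relevant : ∀ i (Q : ℕ → Set) l → All (λ e → Q (proj₁ e)) l → All (λ e → Q (proj₁ e)) (relevant i l)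
All-relevant i Q [] a = []
All-relevant i Q ((p , c) ∷ l) (q ∷ a) rewrite relevant-∷ i p c l =
  All.++⁺ (single (c == i) (c == suc i)) (All-relevant i Q l a)
  where
  single : ∀ b₁ b₂ → All (λ e → Q (proj₁ e))
    (if b₁ then (p , false) ∷ [] else (if b₂ then (p , true) ∷ [] else []))
  single true _ = q ∷ []
  single false true = q ∷ []
  single false false = []

swap : ℕ → ℕ → ℕ → ℕ
swap a b p with p ≟ a
... | yes _ = b
... | no _ with p ≟ b
... | yes _ = a
... | no _ = p

swap-left : ∀ a b → swap a b a ≡ b
swap-left a b with a ≟ a
... | yes _ = refl
... | no n = ⊥-elim (n refl)

swap-right : ∀ a b → a ≢ b → swap a b b ≡ a
swap-right a b ne with b ≟ a
... | yes e = ⊥-elim (ne (sym e))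
... | no _ with b ≟ b
... | yes _ = refl
... | no n = ⊥-elim (n refl)

swap-other : ∀ a b p → p ≢ a → p ≢ b → swap a b p ≡ p
swap-other a b p n₁ n₂ with p ≟ a
... | yes e = ⊥-elim (n₁ e)
... | no _ with p ≟ b
... | yes e = ⊥-elim (n₂ e)
... | no _ = refl

swap-involutive : ∀ a b → a ≢ b → ∀ p → swap a b (swap a b p) ≡ p
swap-involutive a b ne p with p ≟ a
... | yes refl = swap-right p b ne
... | no n₁ with p ≟ b
... | yes refl = swap-left a p
... | no n₂ = swap-other a b p n₁ n₂

any-map : ∀ (σ : ℕ → ℕ) → (∀ p → σ (σ p) ≡ p) → ∀ p U → any (_== p) (map σ U) ≡ any (_== σ p) U
any-map σ inv p [] = refl
any-map σ inv p (q ∷ U) rewrite any-map σ inv p U =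
  cong (_∨ any (_== σ p) U)
    (==-cong (σ q) p q (σ p) (λ e → trans (sym (inv q)) (cong σ e)) (λ e → trans (cong σ e) (inv p)))

positions-relabel : ∀ σ l → map proj₁ (relabel σ l) ≡ map σ (map proj₁ l)
positions-relabel σ [] = refl
positions-relabel σ ((p , b) ∷ l) = cong (σ p ∷_) (positions-relabel σ l)

flipAt : ℕ → List ℕ → ℕ × ℕ → ℕ
flipAt i w = flipLetter i (unmatched i w)

indexFrom-split : ∀ a m b → indexFrom 0 (a ++ m ++ b) ≡
  indexFrom 0 a ++ indexFrom (length a) m ++ indexFrom (length m + length a) b
indexFrom-split a m b
  rewrite indexFrom-++ 0 a (m ++ b) | +-comm (length a) 0 | indexFrom-++ (length a) m b = refl

map-split : ∀ (g : ℕ × ℕ → ℕ) a m b → map g (indexFrom 0 (a ++ m ++ b)) ≡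
  map g (indexFrom 0 a) ++ map g (indexFrom (length a) m) ++ map g (indexFrom (length m + length a) b)
map-split g a m b = begin
  map g (indexFrom 0 (a ++ m ++ b))                        ≡⟨ cong (map g) (indexFrom-split a m b) ⟩
  map g (indexFrom 0 a ++ indexFrom (length a) m ++ B)     ≡⟨ map-++ g (indexFrom 0 a) _ ⟩
  map g (indexFrom 0 a) ++ map g (indexFrom (length a) m ++ B)
                                      ≡⟨ cong (map g (indexFrom 0 a) ++_) (map-++ g (indexFrom (length a) m) B) ⟩
  map g (indexFrom 0 a) ++ map g (indexFrom (length a) m) ++ map g B ∎
  where
  open ≡-Reasoning
  B = indexFrom (length m + length a) b

regroup : ∀ (u u' c v' v : List ℕ) → u ++ (u' ++ c ++ v') ++ v ≡ (u ++ u') ++ c ++ (v' ++ v)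
regroup u u' c v' v
  rewrite ++-assoc u' (c ++ v') v | ++-assoc c v' v | ++-assoc u u' (c ++ v' ++ v) = refl

∼-cong : ∀ {p q} → p ∼ q → ∀ u v → (u ++ p ++ v) ∼ (u ++ q ++ v)
∼-cong (knuth₁ u' v' {x} {y} {z} xy yz) u v =
  subst₂ _∼_ (sym (regroup u u' (x ∷ z ∷ y ∷ []) v' v)) (sym (regroup u u' (z ∷ x ∷ y ∷ []) v' v))
    (knuth₁ (u ++ u') (v' ++ v) xy yz)
∼-cong (knuth₂ u' v' {x} {y} {z} xy yz) u v =
  subst₂ _∼_ (sym (regroup u u' (y ∷ x ∷ z ∷ []) v' v)) (sym (regroup u u' (y ∷ z ∷ x ∷ []) v' v))
    (knuth₂ (u ++ u') (v' ++ v) xy yz)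
∼-cong ∼-refl u v = ∼-refl
∼-cong (∼-sym h) u v = ∼-sym (∼-cong h u v)
∼-cong (∼-trans h h') u v = ∼-trans (∼-cong h u v) (∼-cong h' u v)

record Agree (i : ℕ) (a w w' b : List ℕ) : Set where
  constructor agree
  field
    pre mid mid' post : List ℕ
    length-pre  : length pre ≡ length a
    length-post : length post ≡ length b
    knuth       : mid ∼ mid'
    image       : s i (a ++ w ++ b) ≡ pre ++ mid ++ post
    image'      : s i (a ++ w' ++ b) ≡ pre ++ mid' ++ post

-- Window lemma: if the unmatched marks of a ++ m' ++ b are those of
-- a ++ m ++ b renamed by an involution σ moving only window positions, then
-- the letters outside the window are flipped alike in both words, and the
-- letter at position p of the window m' is flipped as the one at σ p in m.
agree-relabel : ∀ i a m m' b (σ : ℕ → ℕ) → length m' ≡ length m →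
  (∀ p → σ (σ p) ≡ p) → (∀ p → p < length a ⊎ length m + length a ≤ p → σ p ≡ p) →
  reduce (marks i (a ++ m' ++ b)) ≡ relabel σ (reduce (marks i (a ++ m ++ b))) →
  map (flipAt i (a ++ m ++ b)) (indexFrom (length a) m) ∼
    map (λ e → flipAt i (a ++ m ++ b) (σ (proj₁ e) , proj₂ e)) (indexFrom (length a) m') →
  Agree i a m m' b
agree-relabel i a m m' b σ same-length inv outside unmatched-σ window =
  agree (map g A) (map g (indexFrom (length a) m)) (map gσ (indexFrom (length a) m')) (map g B)
    (trans (length-map g A) (length-indexFrom 0 a))
    (trans (length-map g B) (length-indexFrom _ b))
    window (map-split g a m b) image'
  where
  W = a ++ m ++ b
  W' = a ++ m' ++ b
  g = flipAt i W
  g' = flipAt i W'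
  gσ : ℕ × ℕ → ℕ
  gσ e = g (σ (proj₁ e) , proj₂ e)
  A = indexFrom 0 a
  B = indexFrom (length m + length a) b
  g'≗gσ : ∀ e → g' e ≡ gσ e
  g'≗gσ (p , c) = cong (λ u → if u then (if c == i then suc i else if c == suc i then i else c) else c)
    (begin
      any (_== p) (unmatched i W')                               ≡⟨ cong (λ V → any (_== p) (map proj₁ V)) unmatched-σ ⟩
      any (_== p) (map proj₁ (relabel σ (reduce (marks i W))))   ≡⟨ cong (any (_== p)) (positions-relabel σ (reduce (marks i W))) ⟩
      any (_== p) (map σ (unmatched i W))                        ≡⟨ any-map σ inv p (unmatched i W) ⟩
      any (_== σ p) (unmatched i W)                              ∎)
    where open ≡-Reasoning
  fixed : ∀ {l} → All (λ e → proj₁ e < length a ⊎ length m + length a ≤ proj₁ e) l → map g' l ≡ map g l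
  fixed hs = map-cong-local
    (All.map (λ {e} h → trans (g'≗gσ e) (cong (λ q → g (q , proj₂ e)) (outside (proj₁ e) h))) hs)
  image' : s i W' ≡ map g A ++ map gσ (indexFrom (length a) m') ++ map g B
  image' = begin
    s i W'                                                                   ≡⟨ map-split g' a m' b ⟩
    map g' A ++ map g' (indexFrom (length a) m') ++ map g' (indexFrom (length m' + length a) b)
      ≡⟨ cong (λ n → map g' A ++ map g' (indexFrom (length a) m') ++ map g' (indexFrom (n + length a) b)) same-length ⟩
    map g' A ++ map g' (indexFrom (length a) m') ++ map g' B
      ≡⟨ cong₂ _++_ (fixed (All.map inj₁ (indexFrom-< 0 a)))
                    (cong₂ _++_ (map-cong g'≗gσ _) (fixed (All.map inj₂ (indexFrom-≥ _ b)))) ⟩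
    map g A ++ map gσ (indexFrom (length a) m') ++ map g B ∎
    where open ≡-Reasoning

exchange : ℕ → ℕ → ℕ
exchange i c = if c == i then suc i else if c == suc i then i else c

flipIf : ℕ → Bool → ℕ → ℕ
flipIf i b c = if b then exchange i c else c

survives : List Mark → ℕ → Bool
survives u p = any (_== p) (map proj₁ (reduce u))

exchange-lower : ∀ i → exchange i i ≡ suc i
exchange-lower i rewrite ==-refl i = refl

exchange-upper : ∀ i → exchange i (suc i) ≡ i
exchange-upper i rewrite ==-no (suc≢ i) | ==-refl (suc i) = refl

flipIf-irrelevant : ∀ i b c → Irrelevant i c → flipIf i b c ≡ c
flipIf-irrelevant i true c (n₁ , n₂) rewrite ==-no n₁ | ==-no n₂ = refl
flipIf-irrelevant i false c _ = refl

data Kind (i c : ℕ) : Set where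
  lower : c ≡ i → Kind i c
  upper : c ≡ suc i → Kind i c
  other : Irrelevant i c → Kind i c

kind : ∀ i c → Kind i c
kind i c with c ≟ i
... | yes e = lower e
... | no n₁ with c ≟ suc i
... | yes e = upper e
... | no n₂ = other (n₁ , n₂)

Relevant-Irrelevant : ∀ {i c} → Relevant i c → Irrelevant i c → ⊥
Relevant-Irrelevant (inj₁ e) (n , _) = n e
Relevant-Irrelevant (inj₂ e) (_ , n) = n e

other-irrelevant : ∀ {i c c'} → Irrelevant i c ⊎ Irrelevant i c' → Relevant i c → Irrelevant i c'
other-irrelevant (inj₁ ic) rc = ⊥-elim (Relevant-Irrelevant rc ic)
other-irrelevant (inj₂ ic') rc = ic'

Relevant-≤ : ∀ {i c} → Relevant i c → c ≤ suc i
Relevant-≤ (inj₁ refl) = n≤1+n _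
Relevant-≤ (inj₂ refl) = ≤-refl

Relevant-≥ : ∀ {i c} → Relevant i c → i ≤ c
Relevant-≥ (inj₁ refl) = ≤-refl
Relevant-≥ (inj₂ refl) = n≤1+n _

flipIf-≥ : ∀ i b c → Relevant i c → i ≤ flipIf i b c
flipIf-≥ i false c r = Relevant-≥ r
flipIf-≥ i true c (inj₁ refl) rewrite exchange-lower i = n≤1+n i
flipIf-≥ i true c (inj₂ refl) rewrite exchange-upper i = ≤-refl

flipIf-≤ : ∀ i b c → Relevant i c → flipIf i b c ≤ suc i
flipIf-≤ i false c r = Relevant-≤ r
flipIf-≤ i true c (inj₁ refl) rewrite exchange-lower i = ≤-refl
flipIf-≤ i true c (inj₂ refl) rewrite exchange-upper i = n≤1+n i

irrelevant-below : ∀ {i x} → x ≤ suc i → Irrelevant i x → x < i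
irrelevant-below h (n₁ , n₂) = ≤∧≢⇒< (≤-pred (≤∧≢⇒< h n₂)) n₁

irrelevant-above : ∀ {i y} → i ≤ y → Irrelevant i y → suc i < y
irrelevant-above h (n₁ , n₂) = ≤∧≢⇒< (≤∧≢⇒< h (≢-sym n₁)) (≢-sym n₂)

-- Applying flips to x ≤ y (resp. x < y) keeps the comparison, provided it is
-- kept when both letters are relevant: the exchange of i and i+1 does not
-- cross any other letter.
flipIf-mono-≤ : ∀ i x y bx by → x ≤ y →
  (Relevant i x → Relevant i y → flipIf i bx x ≤ flipIf i by y) → flipIf i bx x ≤ flipIf i by y
flipIf-mono-≤ i x y bx by le both with kind i x | kind i y
... | other ix | other iy rewrite flipIf-irrelevant i bx x ix | flipIf-irrelevant i by y iy = le
... | other ix | lower e rewrite flipIf-irrelevant i bx x ix =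
  ≤-trans (<⇒≤ (irrelevant-below (≤-trans le (Relevant-≤ (inj₁ e))) ix)) (flipIf-≥ i by y (inj₁ e))
... | other ix | upper e rewrite flipIf-irrelevant i bx x ix =
  ≤-trans (<⇒≤ (irrelevant-below (≤-trans le (Relevant-≤ (inj₂ e))) ix)) (flipIf-≥ i by y (inj₂ e))
... | lower e | other iy rewrite flipIf-irrelevant i by y iy =
  ≤-trans (flipIf-≤ i bx x (inj₁ e)) (<⇒≤ (irrelevant-above (≤-trans (Relevant-≥ (inj₁ e)) le) iy))
... | upper e | other iy rewrite flipIf-irrelevant i by y iy =
  ≤-trans (flipIf-≤ i bx x (inj₂ e)) (<⇒≤ (irrelevant-above (≤-trans (Relevant-≥ (inj₂ e)) le) iy))
... | lower e₁ | lower e₂ = both (inj₁ e₁) (inj₁ e₂)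
... | lower e₁ | upper e₂ = both (inj₁ e₁) (inj₂ e₂)
... | upper e₁ | lower e₂ = both (inj₂ e₁) (inj₁ e₂)
... | upper e₁ | upper e₂ = both (inj₂ e₁) (inj₂ e₂)

flipIf-mono-< : ∀ i x y bx by → x < y →
  (Relevant i x → Relevant i y → flipIf i bx x < flipIf i by y) → flipIf i bx x < flipIf i by y
flipIf-mono-< i x y bx by lt both with kind i x | kind i y
... | other ix | other iy rewrite flipIf-irrelevant i bx x ix | flipIf-irrelevant i by y iy = lt
... | other ix | lower e rewrite flipIf-irrelevant i bx x ix =
  <-≤-trans (irrelevant-below (≤-trans (<⇒≤ lt) (Relevant-≤ (inj₁ e))) ix) (flipIf-≥ i by y (inj₁ e))
... | other ix | upper e rewrite flipIf-irrelevant i bx x ix =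
  <-≤-trans (irrelevant-below (≤-trans (<⇒≤ lt) (Relevant-≤ (inj₂ e))) ix) (flipIf-≥ i by y (inj₂ e))
... | lower e | other iy rewrite flipIf-irrelevant i by y iy =
  ≤-<-trans (flipIf-≤ i bx x (inj₁ e)) (irrelevant-above (≤-trans (Relevant-≥ (inj₁ e)) (<⇒≤ lt)) iy)
... | upper e | other iy rewrite flipIf-irrelevant i by y iy =
  ≤-<-trans (flipIf-≤ i bx x (inj₂ e)) (irrelevant-above (≤-trans (Relevant-≥ (inj₂ e)) (<⇒≤ lt)) iy)
... | lower e₁ | lower e₂ = both (inj₁ e₁) (inj₁ e₂)
... | lower e₁ | upper e₂ = both (inj₁ e₁) (inj₂ e₂)
... | upper e₁ | lower e₂ = both (inj₂ e₁) (inj₁ e₂)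
... | upper e₁ | upper e₂ = both (inj₂ e₁) (inj₂ e₂)

survives⇒Mem : ∀ p m → any (_== p) (map proj₁ m) ≡ true → Mem p m
survives⇒Mem p ((q , b) ∷ m) h with q == p in e
... | true = here (==-yes e)
... | false = there (survives⇒Mem p m h)

Mem⇒survives : ∀ p m → Mem p m → any (_== p) (map proj₁ m) ≡ true
Mem⇒survives p ((q , b) ∷ m) (here refl) rewrite ==-refl q = refl
Mem⇒survives p ((q , b) ∷ m) (there a) rewrite Mem⇒survives p m a with q == p
... | true = refl
... | false = refl

not-survives : ∀ u p → ¬ Mem p (reduce u) → survives u p ≡ false
not-survives u p n with survives u p in e
... | true = ⊥-elim (n (survives⇒Mem p (reduce u) e))
... | false = refl

flipIf-lowers : ∀ i bx by → (bx ≡ true → by ≡ true) → flipIf i bx i ≤ flipIf i by i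
flipIf-lowers i false false h = ≤-refl
flipIf-lowers i false true h rewrite exchange-lower i = n≤1+n i
flipIf-lowers i true true h = ≤-refl
flipIf-lowers i true false h with h refl
... | ()

flipIf-mixed : ∀ i bx by → (bx ≡ true → by ≡ true → ⊥) → flipIf i bx i ≤ flipIf i by (suc i)
flipIf-mixed i false false h = n≤1+n i
flipIf-mixed i false true h rewrite exchange-upper i = ≤-refl
flipIf-mixed i true false h rewrite exchange-lower i = ≤-refl
flipIf-mixed i true true h = ⊥-elim (h refl refl)

flipIf-uppers : ∀ i bx by → (by ≡ true → bx ≡ true) → flipIf i bx (suc i) ≤ flipIf i by (suc i)
flipIf-uppers i false false h = ≤-refl
flipIf-uppers i true false h rewrite exchange-upper i = n≤1+n i
flipIf-uppers i true true h = ≤-refl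
flipIf-uppers i false true h with h refl
... | ()

adjacent-flip-≤ : ∀ i x y P Q lx ly u → lx ≢ ly → Fresh lx P → Fresh ly P → Fresh lx Q → Fresh ly Q →
  u ≡ P ++ markOf i lx x ++ markOf i ly y ++ Q → x ≤ y → Relevant i x → Relevant i y →
  flipIf i (survives u lx) x ≤ flipIf i (survives u ly) y
adjacent-flip-≤ i x y P Q lx ly u ne fxP fyP fxQ fyQ refl le (inj₁ refl) (inj₁ refl)
  rewrite markOf-lower i lx | markOf-lower i ly =
  flipIf-lowers i _ _ λ h →
    Mem⇒survives ly _ (lowerPair-survives lx ly ne P Q fxP fxQ (survives⇒Mem lx _ h))
adjacent-flip-≤ i x y P Q lx ly u ne fxP fyP fxQ fyQ refl le (inj₁ refl) (inj₂ refl)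
  rewrite markOf-lower i lx | markOf-upper i ly =
  flipIf-mixed i _ _ λ h₁ h₂ →
    mixedPair-not-both P Q lx ly ne fxP fyP fxQ fyQ (survives⇒Mem lx _ h₁) (survives⇒Mem ly _ h₂)
adjacent-flip-≤ i x y P Q lx ly u ne fxP fyP fxQ fyQ eu le (inj₂ refl) (inj₁ refl) =
  ⊥-elim (<-irrefl refl le)
adjacent-flip-≤ i x y P Q lx ly u ne fxP fyP fxQ fyQ refl le (inj₂ refl) (inj₂ refl)
  rewrite markOf-upper i lx | markOf-upper i ly =
  flipIf-uppers i _ _ λ h →
    Mem⇒survives lx _ (upperPair-survives lx ly ne P Q fyP fxQ fyQ (survives⇒Mem ly _ h))

-- Letters y < z where the mark of z directly precedes that of y: both marks
-- cancel ("i+1 i"), so neither letter flips.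
adjacent-flip-< : ∀ i y z P Q lz ly u → Fresh ly (P ++ Q) → Fresh lz (P ++ Q) →
  u ≡ P ++ markOf i lz z ++ markOf i ly y ++ Q → y < z → Relevant i y → Relevant i z →
  flipIf i (survives u ly) y < flipIf i (survives u lz) z
adjacent-flip-< i y z P Q lz ly u fy fz refl lt (inj₁ refl) (inj₂ refl)
  rewrite markOf-lower i ly | markOf-upper i lz
        | not-survives (P ++ (lz , true) ∷ (ly , false) ∷ Q) ly (cancelledPair-gone P Q lz ly ly fy)
        | not-survives (P ++ (lz , true) ∷ (ly , false) ∷ Q) lz (cancelledPair-gone P Q lz ly lz fz) =
  n<1+n i
adjacent-flip-< i y z P Q lz ly u fy fz eu lt (inj₁ refl) (inj₁ refl) = ⊥-elim (<-irrefl refl lt)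
adjacent-flip-< i y z P Q lz ly u fy fz eu lt (inj₂ refl) (inj₁ refl) =
  ⊥-elim (<-irrefl refl (<-trans lt (n<1+n i)))
adjacent-flip-< i y z P Q lz ly u fy fz eu lt (inj₂ refl) (inj₂ refl) = ⊥-elim (<-irrefl refl lt)

markOf-commute : ∀ i p q c c' rest → Irrelevant i c ⊎ Irrelevant i c' →
  markOf i p c ++ markOf i q c' ++ rest ≡ markOf i q c' ++ markOf i p c ++ rest
markOf-commute i p q c c' rest (inj₁ ic) rewrite markOf-irrelevant i p c ic = refl
markOf-commute i p q c c' rest (inj₂ ic') rewrite markOf-irrelevant i q c' ic' = refl

module Window (i : ℕ) (a b : List ℕ) where

  k : ℕ
  k = length a

  at : Fin 3 → ℕ
  at d = toℕ d + k

  Outside : ℕ → Set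
  Outside p = p < k ⊎ 3 + k ≤ p

  Before After : List Mark
  Before = relevant i (indexFrom 0 a)
  After = relevant i (indexFrom (3 + k) b)

  outside-≢ : ∀ d p → Outside p → p ≢ at d
  outside-≢ d p (inj₁ lt) refl = <⇒≱ lt (m≤n+m k (toℕ d))
  outside-≢ d p (inj₂ ge) refl = <⇒≱ (+-monoˡ-< k (toℕ<n d)) ge

  at-distinct : ∀ {d e} → toℕ d < toℕ e → at d ≢ at e
  at-distinct lt = <⇒≢ (+-monoˡ-< k lt)

  Before-fresh : ∀ d → Fresh (at d) Before
  Before-fresh d = All.map (λ lt → outside-≢ d _ (inj₁ lt))
    (All-relevant i (_< k) (indexFrom 0 a) (indexFrom-< 0 a))

  After-fresh : ∀ d → Fresh (at d) After
  After-fresh d = All.map (λ ge → outside-≢ d _ (inj₂ ge))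
    (All-relevant i (3 + k ≤_) (indexFrom (3 + k) b) (indexFrom-≥ (3 + k) b))

  outside-fresh : ∀ d → Fresh (at d) (Before ++ After)
  outside-fresh d = All.++⁺ (Before-fresh d) (After-fresh d)

  fresh-beside : ∀ d e c → at d ≢ at e → Fresh (at e) (Before ++ (at d , c) ∷ After)
  fresh-beside d e c ne = All.++⁺ (Before-fresh e) (ne ∷ After-fresh e)

  marks-window : ∀ c₀ c₁ c₂ → marks i (a ++ c₀ ∷ c₁ ∷ c₂ ∷ b) ≡
    Before ++ markOf i k c₀ ++ markOf i (suc k) c₁ ++ markOf i (suc (suc k)) c₂ ++ After
  marks-window c₀ c₁ c₂
    rewrite indexFrom-split a (c₀ ∷ c₁ ∷ c₂ ∷ []) b
          | relevant-++ i (indexFrom 0 a) (indexFrom k (c₀ ∷ c₁ ∷ c₂ ∷ []) ++ indexFrom (3 + k) b)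
          | relevant-∷ i k c₀ ((suc k , c₁) ∷ (suc (suc k) , c₂) ∷ indexFrom (3 + k) b)
          | relevant-∷ i (suc k) c₁ ((suc (suc k) , c₂) ∷ indexFrom (3 + k) b)
          | relevant-∷ i (suc (suc k)) c₂ (indexFrom (3 + k) b) = refl

  marks-window-skip₀ : ∀ c₀ c₁ c₂ → Irrelevant i c₀ → marks i (a ++ c₀ ∷ c₁ ∷ c₂ ∷ b) ≡
    Before ++ markOf i (suc k) c₁ ++ markOf i (suc (suc k)) c₂ ++ After
  marks-window-skip₀ c₀ c₁ c₂ ic rewrite marks-window c₀ c₁ c₂ | markOf-irrelevant i k c₀ ic = refl

  marks-window-skip₁ : ∀ c₀ c₁ c₂ → Irrelevant i c₁ → marks i (a ++ c₀ ∷ c₁ ∷ c₂ ∷ b) ≡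
    Before ++ markOf i k c₀ ++ markOf i (suc (suc k)) c₂ ++ After
  marks-window-skip₁ c₀ c₁ c₂ ic rewrite marks-window c₀ c₁ c₂ | markOf-irrelevant i (suc k) c₁ ic = refl

  marks-window-skip₂ : ∀ c₀ c₁ c₂ → Irrelevant i c₂ → marks i (a ++ c₀ ∷ c₁ ∷ c₂ ∷ b) ≡
    Before ++ markOf i k c₀ ++ markOf i (suc k) c₁ ++ After
  marks-window-skip₂ c₀ c₁ c₂ ic rewrite marks-window c₀ c₁ c₂ | markOf-irrelevant i (suc (suc k)) c₂ ic = refl

  relabel-fixed : ∀ σ l → All (λ e → σ (proj₁ e) ≡ proj₁ e) l → relabel σ l ≡ l
  relabel-fixed σ [] _ = refl
  relabel-fixed σ ((p , c) ∷ l) (h ∷ hs) = cong₂ _∷_ (cong (_, c) h) (relabel-fixed σ l hs)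

  relabel-Before : ∀ σ → (∀ p → Outside p → σ p ≡ p) → relabel σ Before ≡ Before
  relabel-Before σ fix = relabel-fixed σ Before
    (All-relevant i (λ q → σ q ≡ q) (indexFrom 0 a) (All.map (λ lt → fix _ (inj₁ lt)) (indexFrom-< 0 a)))

  relabel-After : ∀ σ → (∀ p → Outside p → σ p ≡ p) → relabel σ After ≡ After
  relabel-After σ fix = relabel-fixed σ After
    (All-relevant i (λ q → σ q ≡ q) (indexFrom (3 + k) b)
      (All.map (λ ge → fix _ (inj₂ ge)) (indexFrom-≥ (3 + k) b)))

  relabel-window : ∀ σ → (∀ p → Outside p → σ p ≡ p) → ∀ l₀ l₁ l₂ →
    relabel σ (Before ++ l₀ ++ l₁ ++ l₂ ++ After) ≡
    Before ++ relabel σ l₀ ++ relabel σ l₁ ++ relabel σ l₂ ++ After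
  relabel-window σ fix l₀ l₁ l₂
    rewrite map-++ (relabelMark σ) Before (l₀ ++ l₁ ++ l₂ ++ After)
          | map-++ (relabelMark σ) l₀ (l₁ ++ l₂ ++ After) | map-++ (relabelMark σ) l₁ (l₂ ++ After)
          | map-++ (relabelMark σ) l₂ After | relabel-Before σ fix | relabel-After σ fix = refl

  relabel-marks-window : ∀ σ → (∀ p → Outside p → σ p ≡ p) → ∀ {p₀ p₁ p₂} →
    σ k ≡ p₀ → σ (suc k) ≡ p₁ → σ (suc (suc k)) ≡ p₂ → ∀ c₀ c₁ c₂ →
    relabel σ (marks i (a ++ c₀ ∷ c₁ ∷ c₂ ∷ b)) ≡
    Before ++ markOf i p₀ c₀ ++ markOf i p₁ c₁ ++ markOf i p₂ c₂ ++ After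
  relabel-marks-window σ fix refl refl refl c₀ c₁ c₂
    rewrite marks-window c₀ c₁ c₂
          | relabel-window σ fix (markOf i k c₀) (markOf i (suc k) c₁) (markOf i (suc (suc k)) c₂)
          | markOf-relabel i σ k c₀ | markOf-relabel i σ (suc k) c₁
          | markOf-relabel i σ (suc (suc k)) c₂ = refl

  transpose : Fin 3 → Fin 3 → ℕ → ℕ
  transpose d e = swap (at d) (at e)

  transpose-outside : ∀ d e p → Outside p → transpose d e p ≡ p
  transpose-outside d e p o = swap-other (at d) (at e) p (outside-≢ d p o) (outside-≢ e p o)

-- The move x z y ~ z x y when x or z is irrelevant: the marks of both words
-- agree up to exchanging the first two window positions, so the window keeps
-- its letters, flipped consistently, and the Knuth relation survives.
knuth₁-irrelevant : ∀ i a b {x y z} → Irrelevant i x ⊎ Irrelevant i z → x ≤ y → y < z →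
  Agree i a (x ∷ z ∷ y ∷ []) (z ∷ x ∷ y ∷ []) b
knuth₁-irrelevant i a b {x} {y} {z} irr xy yz =
  agree-relabel i a (x ∷ z ∷ y ∷ []) (z ∷ x ∷ y ∷ []) b σ refl
    (swap-involutive k (suc k) k≢k+1) (transpose-outside zero (suc zero)) unmatched-σ window
  where
  open Window i a b
  σ = transpose zero (suc zero)
  W = a ++ x ∷ z ∷ y ∷ b
  u = marks i W
  g = flipAt i W
  k≢k+1 : k ≢ suc k
  k≢k+1 = at-distinct {zero} {suc zero} (s≤s z≤n)
  σ-first : σ k ≡ suc k
  σ-first = swap-left k (suc k)
  σ-second : σ (suc k) ≡ k
  σ-second = swap-right k (suc k) k≢k+1
  σ-last : σ (suc (suc k)) ≡ suc (suc k)
  σ-last = swap-other k (suc k) (suc (suc k))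
    (≢-sym (at-distinct {zero} {suc (suc zero)} (s≤s z≤n)))
    (≢-sym (at-distinct {suc zero} {suc (suc zero)} (s≤s (s≤s z≤n))))
  unmatched-σ : reduce (marks i (a ++ z ∷ x ∷ y ∷ b)) ≡ relabel σ (reduce u)
  unmatched-σ = begin
    reduce (marks i (a ++ z ∷ x ∷ y ∷ b))  ≡⟨ cong reduce (marks-window z x y) ⟩
    reduce (Before ++ markOf i k z ++ markOf i (suc k) x ++ markOf i (suc (suc k)) y ++ After)
      ≡⟨ cong (λ l → reduce (Before ++ l)) (markOf-commute i k (suc k) z x _ (Sum.swap irr)) ⟩
    reduce (Before ++ markOf i (suc k) x ++ markOf i k z ++ markOf i (suc (suc k)) y ++ After)
      ≡⟨ cong reduce (sym (relabel-marks-window σ (transpose-outside _ _) σ-first σ-second σ-last x z y)) ⟩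
    reduce (relabel σ u)  ≡⟨ reduce-relabel σ u ⟩
    relabel σ (reduce u)  ∎
    where open ≡-Reasoning
  window : (g (k , x) ∷ g (suc k , z) ∷ g (suc (suc k) , y) ∷ []) ∼
           (g (σ k , z) ∷ g (σ (suc k) , x) ∷ g (σ (suc (suc k)) , y) ∷ [])
  window rewrite σ-first | σ-second | σ-last =
    knuth₁ [] [] (flipIf-mono-≤ i x y (survives u k) (survives u (suc (suc k))) xy both-≤)
                 (flipIf-mono-< i y z (survives u (suc (suc k))) (survives u (suc k)) yz both-<)
    where
    both-≤ : Relevant i x → Relevant i y → flipIf i (survives u k) x ≤ flipIf i (survives u (suc (suc k))) y
    both-≤ rx ry = adjacent-flip-≤ i x y Before After k (suc (suc k)) u
      (at-distinct {zero} {suc (suc zero)} (s≤s z≤n))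
      (Before-fresh zero) (Before-fresh (suc (suc zero))) (After-fresh zero) (After-fresh (suc (suc zero)))
      (marks-window-skip₁ x z y (other-irrelevant irr rx)) xy rx ry
    both-< : Relevant i y → Relevant i z → flipIf i (survives u (suc (suc k))) y < flipIf i (survives u (suc k)) z
    both-< ry rz = adjacent-flip-< i y z Before After (suc k) (suc (suc k)) u
      (outside-fresh (suc (suc zero))) (outside-fresh (suc zero))
      (marks-window-skip₀ x z y (other-irrelevant (Sum.swap irr) rz)) yz ry rz

-- The move y x z ~ y z x when x or z is irrelevant: as above, with the last
-- two window positions exchanged.
knuth₂-irrelevant : ∀ i a b {x y z} → Irrelevant i x ⊎ Irrelevant i z → x < y → y ≤ z →
  Agree i a (y ∷ x ∷ z ∷ []) (y ∷ z ∷ x ∷ []) b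
knuth₂-irrelevant i a b {x} {y} {z} irr xy yz =
  agree-relabel i a (y ∷ x ∷ z ∷ []) (y ∷ z ∷ x ∷ []) b σ refl
    (swap-involutive (suc k) (suc (suc k)) k+1≢k+2) (transpose-outside (suc zero) (suc (suc zero)))
    unmatched-σ window
  where
  open Window i a b
  σ = transpose (suc zero) (suc (suc zero))
  W = a ++ y ∷ x ∷ z ∷ b
  u = marks i W
  g = flipAt i W
  k+1≢k+2 : suc k ≢ suc (suc k)
  k+1≢k+2 = at-distinct {suc zero} {suc (suc zero)} (s≤s (s≤s z≤n))
  σ-first : σ k ≡ k
  σ-first = swap-other (suc k) (suc (suc k)) k
    (at-distinct {zero} {suc zero} (s≤s z≤n)) (at-distinct {zero} {suc (suc zero)} (s≤s z≤n))
  σ-second : σ (suc k) ≡ suc (suc k)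
  σ-second = swap-left (suc k) (suc (suc k))
  σ-last : σ (suc (suc k)) ≡ suc k
  σ-last = swap-right (suc k) (suc (suc k)) k+1≢k+2
  unmatched-σ : reduce (marks i (a ++ y ∷ z ∷ x ∷ b)) ≡ relabel σ (reduce u)
  unmatched-σ = begin
    reduce (marks i (a ++ y ∷ z ∷ x ∷ b))  ≡⟨ cong reduce (marks-window y z x) ⟩
    reduce (Before ++ markOf i k y ++ markOf i (suc k) z ++ markOf i (suc (suc k)) x ++ After)
      ≡⟨ cong (λ l → reduce (Before ++ markOf i k y ++ l))
              (markOf-commute i (suc k) (suc (suc k)) z x _ (Sum.swap irr)) ⟩
    reduce (Before ++ markOf i k y ++ markOf i (suc (suc k)) x ++ markOf i (suc k) z ++ After)
      ≡⟨ cong reduce (sym (relabel-marks-window σ (transpose-outside _ _) σ-first σ-second σ-last y x z)) ⟩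
    reduce (relabel σ u)  ≡⟨ reduce-relabel σ u ⟩
    relabel σ (reduce u)  ∎
    where open ≡-Reasoning
  window : (g (k , y) ∷ g (suc k , x) ∷ g (suc (suc k) , z) ∷ []) ∼
           (g (σ k , y) ∷ g (σ (suc k) , z) ∷ g (σ (suc (suc k)) , x) ∷ [])
  window rewrite σ-first | σ-second | σ-last =
    knuth₂ [] [] (flipIf-mono-< i x y (survives u (suc k)) (survives u k) xy both-<)
                 (flipIf-mono-≤ i y z (survives u k) (survives u (suc (suc k))) yz both-≤)
    where
    both-< : Relevant i x → Relevant i y → flipIf i (survives u (suc k)) x < flipIf i (survives u k) y
    both-< rx ry = adjacent-flip-< i x y Before After k (suc k) u
      (outside-fresh (suc zero)) (outside-fresh zero)
      (marks-window-skip₂ y x z (other-irrelevant irr rx)) xy rx ry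
    both-≤ : Relevant i y → Relevant i z → flipIf i (survives u k) y ≤ flipIf i (survives u (suc (suc k))) z
    both-≤ ry rz = adjacent-flip-≤ i y z Before After k (suc (suc k)) u
      (at-distinct {zero} {suc (suc zero)} (s≤s z≤n))
      (Before-fresh zero) (Before-fresh (suc (suc zero))) (After-fresh zero) (After-fresh (suc (suc zero)))
      (marks-window-skip₁ y x z (other-irrelevant (Sum.swap irr) rz)) yz ry rz

not-survives-via : ∀ u v p → reduce u ≡ reduce v → Fresh p v → survives u p ≡ false
not-survives-via u v p e f = not-survives u p λ m → Mem-Fresh (subst (Mem p) e m) (All-reduce v f)

-- The flips possible in the windows of the moves i (i+1) i ~ (i+1) i i and
-- (i+1) i (i+1) ~ (i+1) (i+1) i, where the adjacent "i+1 i" never flips.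
cancelling-window₁ : ∀ i b₀ b₁ b₂ → b₁ ≡ false → b₂ ≡ false →
  (flipIf i b₀ i ∷ flipIf i b₁ (suc i) ∷ flipIf i b₂ i ∷ []) ∼
  (flipIf i b₂ (suc i) ∷ flipIf i b₁ i ∷ flipIf i b₀ i ∷ [])
cancelling-window₁ i false b₁ b₂ refl refl = knuth₁ [] [] ≤-refl (n<1+n i)
cancelling-window₁ i true b₁ b₂ refl refl rewrite exchange-lower i =
  ∼-sym (knuth₂ [] [] (n<1+n i) ≤-refl)

cancelling-window₂ : ∀ i b₀ b₁ b₂ → b₀ ≡ false → b₁ ≡ false →
  (flipIf i b₀ (suc i) ∷ flipIf i b₁ i ∷ flipIf i b₂ (suc i) ∷ []) ∼
  (flipIf i b₂ (suc i) ∷ flipIf i b₁ (suc i) ∷ flipIf i b₀ i ∷ [])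
cancelling-window₂ i b₀ b₁ false refl refl = knuth₂ [] [] (n<1+n i) ≤-refl
cancelling-window₂ i b₀ b₁ true refl refl rewrite exchange-upper i =
  ∼-sym (knuth₁ [] [] ≤-refl (n<1+n i))

reduce-cancel-after : ∀ P e p q Q → reduce (P ++ e ∷ (p , true) ∷ (q , false) ∷ Q) ≡ reduce (P ++ e ∷ Q)
reduce-cancel-after P e p q Q = begin
  reduce (P ++ e ∷ (p , true) ∷ (q , false) ∷ Q)      ≡⟨ cong reduce (++-assoc P [ e ] _) ⟨
  reduce ((P ++ [ e ]) ++ (p , true) ∷ (q , false) ∷ Q) ≡⟨ reduce-cancel (P ++ [ e ]) p q Q ⟩
  reduce ((P ++ [ e ]) ++ Q)                            ≡⟨ cong reduce (++-assoc P [ e ] Q) ⟩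
  reduce (P ++ e ∷ Q)                                   ∎
  where open ≡-Reasoning

-- In both words the window contains an
-- adjacent "i+1 i", which cancels; what remains is one i, at position k
-- resp. k+2, so the unmatched marks correspond under exchanging k and k+2.
knuth₁-relevant : ∀ i a b → Agree i a (i ∷ suc i ∷ i ∷ []) (suc i ∷ i ∷ i ∷ []) b
knuth₁-relevant i a b =
  agree-relabel i a (i ∷ suc i ∷ i ∷ []) (suc i ∷ i ∷ i ∷ []) b τ refl
    (swap-involutive k (suc (suc k)) k≢k+2) (transpose-outside zero (suc (suc zero))) unmatched-τ window
  where
  open Window i a b
  τ = transpose zero (suc (suc zero))
  g = flipAt i (a ++ i ∷ suc i ∷ i ∷ b)
  u = marks i (a ++ i ∷ suc i ∷ i ∷ b)
  u' = marks i (a ++ suc i ∷ i ∷ i ∷ b)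
  V = Before ++ (k , false) ∷ After
  V' = Before ++ (suc (suc k) , false) ∷ After
  k≢k+2 : k ≢ suc (suc k)
  k≢k+2 = at-distinct {zero} {suc (suc zero)} (s≤s z≤n)
  reduce-u : reduce u ≡ reduce V
  reduce-u rewrite marks-window i (suc i) i | markOf-lower i k | markOf-upper i (suc k)
                 | markOf-lower i (suc (suc k)) = reduce-cancel-after Before (k , false) (suc k) (suc (suc k)) After
  reduce-u' : reduce u' ≡ reduce V'
  reduce-u' rewrite marks-window (suc i) i i | markOf-upper i k | markOf-lower i (suc k)
                  | markOf-lower i (suc (suc k)) = reduce-cancel Before k (suc k) ((suc (suc k) , false) ∷ After)
  V-τ : relabel τ V ≡ V'
  V-τ = trans (relabel-window τ (transpose-outside _ _) ((k , false) ∷ []) [] [])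
              (cong (λ p → Before ++ (p , false) ∷ After) (swap-left k (suc (suc k))))
  unmatched-τ : reduce u' ≡ relabel τ (reduce u)
  unmatched-τ = begin
    reduce u'            ≡⟨ reduce-u' ⟩
    reduce V'            ≡⟨ cong reduce V-τ ⟨
    reduce (relabel τ V) ≡⟨ reduce-relabel τ V ⟩
    relabel τ (reduce V) ≡⟨ cong (relabel τ) reduce-u ⟨
    relabel τ (reduce u) ∎
    where open ≡-Reasoning
  window : (g (k , i) ∷ g (suc k , suc i) ∷ g (suc (suc k) , i) ∷ []) ∼
           (g (τ k , suc i) ∷ g (τ (suc k) , i) ∷ g (τ (suc (suc k)) , i) ∷ [])
  window rewrite swap-left k (suc (suc k)) | swap-right k (suc (suc k)) k≢k+2
               | swap-other k (suc (suc k)) (suc k) (>⇒≢ (n<1+n k)) (<⇒≢ (n<1+n (suc k))) =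
    cancelling-window₁ i (survives u k) (survives u (suc k)) (survives u (suc (suc k)))
      (not-survives-via u V (suc k) reduce-u (fresh-beside zero (suc zero) false (<⇒≢ (n<1+n k))))
      (not-survives-via u V (suc (suc k)) reduce-u (fresh-beside zero (suc (suc zero)) false k≢k+2))

-- The move (i+1) i (i+1) ~ (i+1) (i+1) i.  Again an adjacent "i+1 i" cancels
-- in both words, leaving one i+1 at position k+2 resp. k.
knuth₂-relevant : ∀ i a b → Agree i a (suc i ∷ i ∷ suc i ∷ []) (suc i ∷ suc i ∷ i ∷ []) b
knuth₂-relevant i a b =
  agree-relabel i a (suc i ∷ i ∷ suc i ∷ []) (suc i ∷ suc i ∷ i ∷ []) b τ refl
    (swap-involutive k (suc (suc k)) k≢k+2) (transpose-outside zero (suc (suc zero))) unmatched-τ window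
  where
  open Window i a b
  τ = transpose zero (suc (suc zero))
  g = flipAt i (a ++ suc i ∷ i ∷ suc i ∷ b)
  u = marks i (a ++ suc i ∷ i ∷ suc i ∷ b)
  u' = marks i (a ++ suc i ∷ suc i ∷ i ∷ b)
  V = Before ++ (suc (suc k) , true) ∷ After
  V' = Before ++ (k , true) ∷ After
  k≢k+2 : k ≢ suc (suc k)
  k≢k+2 = at-distinct {zero} {suc (suc zero)} (s≤s z≤n)
  reduce-u : reduce u ≡ reduce V
  reduce-u rewrite marks-window (suc i) i (suc i) | markOf-upper i k | markOf-lower i (suc k)
                 | markOf-upper i (suc (suc k)) = reduce-cancel Before k (suc k) ((suc (suc k) , true) ∷ After)
  reduce-u' : reduce u' ≡ reduce V'
  reduce-u' rewrite marks-window (suc i) (suc i) i | markOf-upper i k | markOf-upper i (suc k)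
                  | markOf-lower i (suc (suc k)) = reduce-cancel-after Before (k , true) (suc k) (suc (suc k)) After
  V-τ : relabel τ V ≡ V'
  V-τ = trans (relabel-window τ (transpose-outside _ _) ((suc (suc k) , true) ∷ []) [] [])
              (cong (λ p → Before ++ (p , true) ∷ After) (swap-right k (suc (suc k)) k≢k+2))
  unmatched-τ : reduce u' ≡ relabel τ (reduce u)
  unmatched-τ = begin
    reduce u'            ≡⟨ reduce-u' ⟩
    reduce V'            ≡⟨ cong reduce V-τ ⟨
    reduce (relabel τ V) ≡⟨ reduce-relabel τ V ⟩
    relabel τ (reduce V) ≡⟨ cong (relabel τ) reduce-u ⟨
    relabel τ (reduce u) ∎
    where open ≡-Reasoning
  window : (g (k , suc i) ∷ g (suc k , i) ∷ g (suc (suc k) , suc i) ∷ []) ∼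
           (g (τ k , suc i) ∷ g (τ (suc k) , suc i) ∷ g (τ (suc (suc k)) , i) ∷ [])
  window rewrite swap-left k (suc (suc k)) | swap-right k (suc (suc k)) k≢k+2
               | swap-other k (suc (suc k)) (suc k) (>⇒≢ (n<1+n k)) (<⇒≢ (n<1+n (suc k))) =
    cancelling-window₂ i (survives u k) (survives u (suc k)) (survives u (suc (suc k)))
      (not-survives-via u V k reduce-u (fresh-beside (suc (suc zero)) zero true (≢-sym k≢k+2)))
      (not-survives-via u V (suc k) reduce-u
        (fresh-beside (suc (suc zero)) (suc zero) true (>⇒≢ (n<1+n (suc k)))))

-- Every move x z y ~ z x y (x ≤ y < z) falls into one of the cases above:
-- if x and z are both relevant, then x = y = i and z = i+1.
local₁ : ∀ i a b {x y z} → x ≤ y → y < z → Agree i a (x ∷ z ∷ y ∷ []) (z ∷ x ∷ y ∷ []) b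
local₁ i a b {x} {y} {z} xy yz with kind i x | kind i z
... | other ix | _ = knuth₁-irrelevant i a b (inj₁ ix) xy yz
... | lower _ | other iz = knuth₁-irrelevant i a b (inj₂ iz) xy yz
... | upper _ | other iz = knuth₁-irrelevant i a b (inj₂ iz) xy yz
... | lower refl | upper refl rewrite ≤-antisym (≤-pred yz) xy = knuth₁-relevant i a b
... | lower refl | lower refl = ⊥-elim (<-irrefl refl (≤-<-trans xy yz))
... | upper refl | upper refl = ⊥-elim (<-irrefl refl (≤-<-trans xy yz))
... | upper refl | lower refl = ⊥-elim (<-irrefl refl (<-trans (≤-<-trans xy yz) (n<1+n i)))

-- Likewise for y x z ~ y z x (x < y ≤ z): if x and z are relevant, then
-- x = i and y = z = i+1.
local₂ : ∀ i a b {x y z} → x < y → y ≤ z → Agree i a (y ∷ x ∷ z ∷ []) (y ∷ z ∷ x ∷ []) b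
local₂ i a b {x} {y} {z} xy yz with kind i x | kind i z
... | other ix | _ = knuth₂-irrelevant i a b (inj₁ ix) xy yz
... | lower _ | other iz = knuth₂-irrelevant i a b (inj₂ iz) xy yz
... | upper _ | other iz = knuth₂-irrelevant i a b (inj₂ iz) xy yz
... | lower refl | upper refl rewrite ≤-antisym yz xy = knuth₂-relevant i a b
... | lower refl | lower refl = ⊥-elim (<-irrefl refl (<-≤-trans xy yz))
... | upper refl | upper refl = ⊥-elim (<-irrefl refl (<-≤-trans xy yz))
... | upper refl | lower refl = ⊥-elim (<-irrefl refl (<-trans (<-≤-trans xy yz) (n<1+n i)))

++-injective : ∀ {a a' b b' : List ℕ} → length a ≡ length a' → a ++ b ≡ a' ++ b' → a ≡ a' × b ≡ b'
++-injective {[]} {[]} _ e = refl , e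
++-injective {x ∷ a} {y ∷ a'} l e with ∷-injective e
... | refl , e' with ++-injective {a} {a'} (suc-injective l) e'
... | refl , refl = refl , refl

++-injective₃ : ∀ {a a' m m' c c' : List ℕ} → length a ≡ length a' → length c ≡ length c' →
  a ++ m ++ c ≡ a' ++ m' ++ c' → a ≡ a' × m ≡ m' × c ≡ c'
++-injective₃ {a} {a'} {m} {m'} {c} {c'} la lc e with ++-injective {a} {a'} la e
... | refl , e' = refl , ++-injective {m} {m'} length-m e'
  where
  length-m : length m ≡ length m'
  length-m = +-cancelʳ-≡ (length c) (length m) (length m')
    (begin
      length m + length c   ≡⟨ length-++ m ⟨
      length (m ++ c)       ≡⟨ cong length e' ⟩
      length (m' ++ c')     ≡⟨ length-++ m' ⟩
      length m' + length c' ≡⟨ cong (length m' +_) lc ⟨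
      length m' + length c  ∎)
    where open ≡-Reasoning

split-length : ∀ (x y l : List ℕ) → length l ≡ length x + length y →
  Σ (List ℕ) λ l₁ → Σ (List ℕ) λ l₂ → l ≡ l₁ ++ l₂ × length l₁ ≡ length x × length l₂ ≡ length y
split-length [] y l e = [] , l , refl , refl , e
split-length (_ ∷ x) y (c ∷ l) e with split-length x y l (suc-injective e)
... | l₁ , l₂ , refl , e₁ , e₂ = c ∷ l₁ , l₂ , refl , cong suc e₁ , e₂

agree-refl : ∀ i a w b → Agree i a w w b
agree-refl i a w b =
  agree (map g (indexFrom 0 a)) (map g (indexFrom (length a) w)) (map g (indexFrom (length a) w))
    (map g (indexFrom (length w + length a) b))
    (trans (length-map g (indexFrom 0 a)) (length-indexFrom 0 a))
    (trans (length-map g (indexFrom (length w + length a) b)) (length-indexFrom _ b))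
    ∼-refl (map-split g a w b) (map-split g a w b)
  where g = flipAt i (a ++ w ++ b)

agree-sym : ∀ {i a w w' b} → Agree i a w w' b → Agree i a w' w b
agree-sym (agree pre mid mid' post lp lq kn img img') = agree pre mid' mid post lp lq (∼-sym kn) img' img

agree-trans : ∀ {i a w w' w'' b} → Agree i a w w' b → Agree i a w' w'' b → Agree i a w w'' b
agree-trans (agree pre mid mid' post lp lq kn img img') (agree pre₂ mid₂ mid₂' post₂ lp₂ lq₂ kn₂ img₂ img₂')
  with ++-injective₃ {pre} {pre₂} {mid'} {mid₂} {post} {post₂} (trans lp (sym lp₂)) (trans lq (sym lq₂))
         (trans (sym img') img₂)
... | refl , refl , refl = agree pre mid mid₂' post lp lq (∼-trans kn kn₂) img img₂'

agree-widen : ∀ {i a u m m' v b} → Agree i (a ++ u) m m' (v ++ b) → Agree i a (u ++ m ++ v) (u ++ m' ++ v) b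
agree-widen {i} {a} {u} {m} {m'} {v} {b} (agree pre mid mid' post lp lq kn img img')
  with split-length a u pre (trans lp (length-++ a)) | split-length v b post (trans lq (length-++ v))
... | t₁ , tu , refl , l₁ , _ | tv , t₄ , refl , _ , l₄ =
  agree t₁ (tu ++ mid ++ tv) (tu ++ mid' ++ tv) t₄ l₁ l₄ (∼-cong kn tu tv)
    (trans (cong (s i) (regroup a u m v b)) (trans img (sym (regroup t₁ tu mid tv t₄))))
    (trans (cong (s i) (regroup a u m' v b)) (trans img' (sym (regroup t₁ tu mid' tv t₄))))

agree-∼ : ∀ i {w w'} → w ∼ w' → ∀ a b → Agree i a w w' b
agree-∼ i (knuth₁ u v xy yz) a b = agree-widen (local₁ i (a ++ u) (v ++ b) xy yz)
agree-∼ i (knuth₂ u v xy yz) a b = agree-widen (local₂ i (a ++ u) (v ++ b) xy yz)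
agree-∼ i (∼-refl {w}) a b = agree-refl i a w b
agree-∼ i (∼-sym h) a b = agree-sym (agree-∼ i h a b)
agree-∼ i (∼-trans h h') a b = agree-trans (agree-∼ i h a b) (agree-∼ i h' a b)

length-s : ∀ i w → length (s i w) ≡ length w
length-s i w = trans (length-map (flipAt i w) (indexFrom 0 w)) (length-indexFrom 0 w)

exchange-∈A : ∀ {n i c} → 1 ≤ i → i <∞ n → c ∈A n → exchange i c ∈A n
exchange-∈A {n} {i} {c} 1≤i i<n c∈A with kind i c
... | lower refl rewrite exchange-lower i = suc∈A i<n
  where
  suc∈A : ∀ {n} → i <∞ n → suc i ∈A n
  suc∈A (ltFin lt) = inFin (s≤s z≤n) lt
  suc∈A ltInf = inInf (s≤s z≤n)
... | upper refl rewrite exchange-upper i = i∈A i<n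
  where
  i∈A : ∀ {n} → i <∞ n → i ∈A n
  i∈A (ltFin lt) = inFin 1≤i (<⇒≤ lt)
  i∈A ltInf = inInf 1≤i
... | other ic rewrite flipIf-irrelevant i true c ic = c∈A

s-Word : ∀ {n i} → 1 ≤ i → i <∞ n → ∀ w → Word n w → Word n (s i w)
s-Word {n} {i} 1≤i i<n w Ww = All.map⁺ (All.map flip∈A (letters 0 w Ww))
  where
  letters : ∀ k v → Word n v → All (λ e → proj₂ e ∈A n) (indexFrom k v)
  letters k [] [] = []
  letters k (x ∷ v) (h ∷ hs) = h ∷ letters (suc k) v hs
  flip∈A : ∀ {e} → proj₂ e ∈A n → flipAt i w e ∈A n
  flip∈A {p , c} c∈A with any (_== p) (unmatched i w)
  ... | true = exchange-∈A 1≤i i<n c∈A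
  ... | false = c∈A

middle-length : ∀ (w₁ w w₄ t₁ t t₄ : List ℕ) → length t₁ ≡ length w₁ → length t₄ ≡ length w₄ →
  length (t₁ ++ t ++ t₄) ≡ length (w₁ ++ w ++ w₄) → length t ≡ length w
middle-length w₁ w w₄ t₁ t t₄ l₁ l₄ e =
  +-cancelʳ-≡ (length w₄) (length t) (length w) (+-cancelˡ-≡ (length w₁) _ _ (begin
    length w₁ + (length t + length w₄)  ≡⟨ cong₂ (λ p q → p + (length t + q)) l₁ l₄ ⟨
    length t₁ + (length t + length t₄)  ≡⟨ cong (length t₁ +_) (length-++ t) ⟨
    length t₁ + length (t ++ t₄)        ≡⟨ length-++ t₁ ⟨
    length (t₁ ++ t ++ t₄)              ≡⟨ e ⟩
    length (w₁ ++ w ++ w₄)              ≡⟨ length-++ w₁ ⟩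
    length w₁ + length (w ++ w₄)        ≡⟨ cong (length w₁ +_) (length-++ w) ⟩
    length w₁ + (length w + length w₄)  ∎))
  where open ≡-Reasoning

lemma5p1 : (n : ℕ∞) (i : ℕ) → 1 ≤ i → i <∞ n →
    (w₁ w₂ w₃ w₄ : List ℕ) →
    Word n w₁ → Word n w₂ → Word n w₃ → Word n w₄ →
    w₂ ∼ w₃ →
    Σ (List ℕ) λ t₁ → Σ (List ℕ) λ t₂ → Σ (List ℕ) λ t₃ → Σ (List ℕ) λ t₄ →
      Word n t₁ × Word n t₂ × Word n t₃ × Word n t₄ ×
      length t₁ ≡ length w₁ × length t₂ ≡ length w₂ ×
      length t₃ ≡ length w₃ × length t₄ ≡ length w₄ ×
      t₂ ∼ t₃ ×
      s i (w₁ ++ w₂ ++ w₄) ≡ t₁ ++ t₂ ++ t₄ ×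
      s i (w₁ ++ w₃ ++ w₄) ≡ t₁ ++ t₃ ++ t₄
lemma5p1 n i 1≤i i<n w₁ w₂ w₃ w₄ W₁ W₂ W₃ W₄ w₂∼w₃ =
  pre , mid , mid' , post ,
  All.++⁻ˡ pre Wimage , All.++⁻ˡ mid (All.++⁻ʳ pre Wimage) ,
  All.++⁻ˡ mid' (All.++⁻ʳ pre Wimage') , All.++⁻ʳ mid (All.++⁻ʳ pre Wimage) ,
  length-pre ,
  middle-length w₁ w₂ w₄ pre mid post length-pre length-post
    (trans (cong length (sym image)) (length-s i (w₁ ++ w₂ ++ w₄))) ,
  middle-length w₁ w₃ w₄ pre mid' post length-pre length-post
    (trans (cong length (sym image')) (length-s i (w₁ ++ w₃ ++ w₄))) ,
  length-post , knuth , image , image'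
  where
  open Agree (agree-∼ i w₂∼w₃ w₁ w₄)
  Wimage : Word n (pre ++ mid ++ post)
  Wimage = subst (Word n) image (s-Word 1≤i i<n _ (All.++⁺ W₁ (All.++⁺ W₂ W₄)))
  Wimage' : Word n (pre ++ mid' ++ post)
  Wimage' = subst (Word n) image' (s-Word 1≤i i<n _ (All.++⁺ W₁ (All.++⁺ W₃ W₄)))
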